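{- Let $n\in\mathbb N$, let $\alpha$ be a composition of $n$ with $\ell$ parts and let $\beta$ be a composition of $n$. (i) A subset $S\subseteq[n-1]$ is $\alpha$-unimodal if and only if for all $k\in S\setminus S_\alpha$ we have $k-1\in S\cup S_\alpha^0$. (ii) If $\alpha\le\beta$ then $U_\beta\subseteq U_\alpha$. (iii) If $\alpha\le\beta$ then $S_\beta$ is $\alpha$-unimodal. (iv) In particular $S_\alpha$ is $\alpha$-unimodal. (v) $|U_\alpha|=2^{\ell-1}\alpha_1\alpha_2\cdots\alpha_\ell$. (vi) $U_\alpha$ is closed under unions and intersections, hence is a sublattice of the Boolean lattice of subsets of $[n-1]$. (vii) The lattice $U_\alpha$ is a direct product of chains, and its Möbius function (from its minimum $\emptyset$) is $\mu(S)=(-1)^{|S|}$ if $S\subseteq S_\alpha\cup\{k+1:k\in S_\alpha^0\}$ and $\mu(S)=0$ otherwise. (viii) Let $V_\alpha=\{\gamma\vDash n: S_\alpha\in U_\gamma\}$. Then $|V_\alpha|=2^{n-1}(3/4)^m$, where $m$ is the number of indices $i\in[\ell-1]$ with $\alpha_i>1$. (ix) $V_\alpha$ is an order ideal, and thus a meet-semilattice, in the lattice of compositions of $n$ ordered by refinement; however $V_\alpha$ is in general not a sublattice. (x) $\displaystyle\sum_{n\ge1}\sum_{\alpha\vDash n}\sum_{S\in U_\alpha}q^{|S|}t^{\ell(\alpha)}z^n=\frac{tz}{1-(1+q)(1+t)z+qz^2}$.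
   Context: For a composition $\alpha=(\alpha_1,\dots,\alpha_\ell)$ of $n$: $S_\alpha=\{\alpha_1,\alpha_1+\alpha_2,\dots,\alpha_1+\dots+\alpha_{\ell-1}\}\subseteq[n-1]$, $S_\alpha^0=S_\alpha\cup\{0\}$, blocks $B_i(\alpha)=\{\alpha_1+\dots+\alpha_{i-1}+1,\dots,\alpha_1+\dots+\alpha_i\}$, and $\alpha\le\beta$ ($\alpha$ refines $\beta$) iff $S_\beta\subseteq S_\alpha$. A set $S\subseteq[n-1]$ is $\alpha$-unimodal if for every $i\in[\ell]$ the set $S\cap(B_i(\alpha)\setminus S_\alpha)$ is an initial segment of $B_i(\alpha)\setminus S_\alpha$ (equivalently, $S$ is the descent set of a permutation whose restriction to each block is of the form decreasing then increasing). $U_\alpha$ denotes the set of $\alpha$-unimodal subsets of $[n-1]$, ordered by inclusion. -}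

module Defs where

open import Data.Nat using (ℕ; zero; suc; _+_; _*_; _∸_; _^_; _≤_; _<_; _<ᵇ_)
open import Data.Bool using (if_then_else_)
open import Data.Fin using (Fin; toℕ)
import Data.Fin as F
open import Data.Fin.Subset using (Subset; _∈_; _⊆_; _∪_; _∩_; ⊥; ∣_∣)
open import Data.Fin.Subset.Properties using (_⊆?_)
open import Data.List using (List; []; _∷_; length; take; map; filter; foldr)
open import Data.Nat.ListAction using (sum; product)
open import Data.List.Relation.Unary.All using (All)
open import Data.List.Relation.Unary.Unique.Propositional using (Unique)
import Data.List.Membership.Propositional as LM
open import Data.Integer using (ℤ; +_; -_) renaming (_+_ to _+ℤ_; _*_ to _*ℤ_; _-_ to _-ℤ_; _^_ to _^ℤ_)
open import Data.Product using (Σ; ∃; ∃-syntax; _×_; _,_; proj₁)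
open import Data.Sum using (_⊎_)
open import Relation.Nullary using (¬_)
open import Relation.Binary.PropositionalEquality using (_≡_; _≢_)

infix 4 _∈ˡ_
_∈ˡ_ : {A : Set} → A → List A → Set
_∈ˡ_ = LM._∈_

IsComposition : ℕ → List ℕ → Set
IsComposition n α = All (λ a → 1 ≤ a) α × sum α ≡ n

pre : ℕ → List ℕ → ℕ
pre j α = sum (take j α)

infix 4 _∈S_
_∈S_ : ℕ → List ℕ → Set
k ∈S α = ∃[ j ] (1 ≤ j × j < length α × k ≡ pre j α)

-- α ≤ β  (α refines β)  iff  S_β ⊆ S_α
Refines : List ℕ → List ℕ → Set
Refines α β = ∀ k → k ∈S β → k ∈S α

InBlock : List ℕ → ℕ → ℕ → Set
InBlock α i x = 1 ≤ i × i ≤ length α × pre (i ∸ 1) α < x × x ≤ pre i α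

-- α-unimodality, for a set S of naturals given as a predicate:
-- for every block i, S ∩ (Bᵢ(α) ∖ S_α) is an initial segment of Bᵢ(α) ∖ S_α.
Unimodal : List ℕ → (ℕ → Set) → Set
Unimodal α S = ∀ i x y → InBlock α i x → InBlock α i y →
  ¬ (x ∈S α) → ¬ (y ∈S α) → x ≤ y → S y → S x

-- subsets of [m] = {1,…,m} are 'Subset m'; Fin index i stands for i+1
infix 4 _∈ₙ_
_∈ₙ_ : {m : ℕ} → ℕ → Subset m → Set
_∈ₙ_ {m} k S = Σ (Fin m) λ i → suc (toℕ i) ≡ k × i ∈ S

-- S ∈ U_α, for S ⊆ [n-1] (the ambient n is fixed by the type Subset (n ∸ 1))
InU : {m : ℕ} → List ℕ → Subset m → Set
InU α S = Unimodal α (λ k → k ∈ₙ S)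

Enumerates : {A : Set} → (A → Set) → List A → Set
Enumerates P L = Unique L × (∀ x → x ∈ˡ L → P x) × (∀ x → P x → x ∈ˡ L)

sumℤ : List ℤ → ℤ
sumℤ = foldr _+ℤ_ (+ 0)

ProductOfChains : {A : Set} → (A → Set) → (A → A → Set) → Set
ProductOfChains {A} P _≼_ =
  Σ ℕ λ k → Σ (Fin k → ℕ) λ c → Σ (Σ A P → (j : Fin k) → Fin (c j)) λ φ →
    (∀ (y : (j : Fin k) → Fin (c j)) → ∃ λ x → ∀ j → φ x j ≡ y j)
    × (∀ x y → (proj₁ x ≼ proj₁ y → ∀ j → φ x j F.≤ φ y j)
             × ((∀ j → φ x j F.≤ φ y j) → proj₁ x ≼ proj₁ y))

MobiusFromEmpty : {m : ℕ} → List (Subset m) → (Subset m → ℤ) → Set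
MobiusFromEmpty L μ =
  μ ⊥ ≡ + 1 × (∀ S → S ∈ˡ L → S ≢ ⊥ → sumℤ (map μ (filter (λ T → T ⊆? S) L)) ≡ + 0)

InSpecial : {m : ℕ} → List ℕ → Subset m → Set
InSpecial α S = ∀ k → k ∈ₙ S → k ∈S α ⊎ ∃[ j ] (k ≡ suc j × (j ≡ 0 ⊎ j ∈S α))

InV : ℕ → List ℕ → List ℕ → Set
InV n α γ = IsComposition n γ × Unimodal γ (λ k → k ∈S α)

countBig : List ℕ → ℕ
countBig [] = 0
countBig (a ∷ []) = 0
countBig (a ∷ b ∷ as) = (if 1 <ᵇ a then 1 else 0) + countBig (b ∷ as)

genCoeff : (C : ℕ → List (List ℕ)) (U : (n : ℕ) → List ℕ → List (Subset (n ∸ 1)))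
           (q t : ℤ) → ℕ → ℤ
genCoeff C U q t zero = + 0
genCoeff C U q t (suc n) =
  sumℤ (map (λ α → sumℤ (map (λ S → (q ^ℤ ∣ S ∣) *ℤ (t ^ℤ length α)) (U (suc n) α)))
            (C (suc n)))

PartI : (n : ℕ) → List ℕ → Set
PartI n α = ∀ (S : Subset (n ∸ 1)) →
  (InU α S → ∀ k → k ∈ₙ S → ¬ (k ∈S α) → (k ∸ 1) ∈ₙ S ⊎ (k ∸ 1) ∈S α ⊎ k ∸ 1 ≡ 0)
  × ((∀ k → k ∈ₙ S → ¬ (k ∈S α) → (k ∸ 1) ∈ₙ S ⊎ (k ∸ 1) ∈S α ⊎ k ∸ 1 ≡ 0) → InU α S)

PartII : (n : ℕ) → List ℕ → List ℕ → Set
PartII n α β = Refines α β → ∀ (S : Subset (n ∸ 1)) → InU β S → InU α S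

PartIII : List ℕ → List ℕ → Set
PartIII α β = Refines α β → Unimodal α (λ k → k ∈S β)

PartIV : List ℕ → Set
PartIV α = Unimodal α (λ k → k ∈S α)

PartV : (n : ℕ) → List ℕ → Set
PartV n α = ∃[ L ] (Enumerates (InU {n ∸ 1} α) L
                    × length L ≡ 2 ^ (length α ∸ 1) * product α)

PartVI : (n : ℕ) → List ℕ → Set
PartVI n α = ∀ (S T : Subset (n ∸ 1)) → InU α S → InU α T →
  InU α (S ∪ T) × InU α (S ∩ T)

PartVII : (n : ℕ) → List ℕ → Set
PartVII n α = ProductOfChains (InU {n ∸ 1} α) _⊆_
  × (∀ (L : List (Subset (n ∸ 1))) → Enumerates (InU α) L →
     ∀ (μ : Subset (n ∸ 1) → ℤ) → MobiusFromEmpty L μ →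
     ∀ S → InU α S →
       (InSpecial α S → μ S ≡ (- (+ 1)) ^ℤ ∣ S ∣) × (¬ InSpecial α S → μ S ≡ + 0))

PartVIII : (n : ℕ) → List ℕ → Set
PartVIII n α = ∃[ L ] (Enumerates (InV n α) L
   × length L * 4 ^ countBig α ≡ 2 ^ (n ∸ 1) * 3 ^ countBig α)

PartIX : (n : ℕ) → List ℕ → Set
PartIX n α =
  (∀ γ δ → IsComposition n δ → Refines δ γ → InV n α γ → InV n α δ)
  × (∀ γ δ → InV n α γ → InV n α δ →
       ∃[ ε ] (InV n α ε × Refines ε γ × Refines ε δ
               × (∀ ζ → IsComposition n ζ → Refines ζ γ → Refines ζ δ → Refines ζ ε)))

PartIXnot : Set
PartIXnot = ∃[ n ] ∃[ α ] ∃[ γ ] ∃[ δ ] ∃[ ε ]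
  (IsComposition n α × InV n α γ × InV n α δ
   × IsComposition n ε × Refines γ ε × Refines δ ε
   × (∀ ζ → IsComposition n ζ → Refines γ ζ → Refines δ ζ → Refines ε ζ)
   × ¬ InV n α ε)

-- Σ_{n≥1} Σ_{α⊨n} Σ_{S∈U_α} q^|S| t^ℓ(α) z^n = tz / (1 - (1+q)(1+t)z + qz²),
-- i.e. coefficientwise: c₀ = 0, c₁ = t, c_{n+2} = (1+q)(1+t)c_{n+1} - q cₙ
-- (as an identity of polynomials in q, t, checked at all integers q, t).
PartX : Set
PartX = ∀ (C : ℕ → List (List ℕ)) → (∀ n → Enumerates (IsComposition n) (C n)) →
  ∀ (U : (n : ℕ) → List ℕ → List (Subset (n ∸ 1))) →
  (∀ n α → IsComposition n α → Enumerates (InU α) (U n α)) →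
  ∀ (q t : ℤ) →
    genCoeff C U q t 1 ≡ t
    × (∀ n → genCoeff C U q t (suc (suc n))
             ≡ ((+ 1 +ℤ q) *ℤ (+ 1 +ℤ t)) *ℤ genCoeff C U q t (suc n)
               -ℤ q *ℤ genCoeff C U q t n)

module Submission where

-- Everything rests on a local reformulation of α-unimodality (LocalForm): S is
-- α-unimodal iff x+1 ∈ S forces x ∈ S whenever x and x+1 are consecutive
-- points outside S_α.  Parts (i)-(iv) and (vi) follow at once.
-- For the enumerative parts a composition of m+1 is coded by its cut vector in
-- {0,1}^m (CutVectors) and a subset of [m] by its characteristic vector; the
-- local condition becomes a two-state transfer-matrix scan of the pair
-- (TransferForm).  Summing transfer weights over all pairs gives the generating
-- function (x), counting the cut vectors compatible with S_α gives |V_α|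
-- (viii), and meets of compositions are unions of cut sets (ix).
-- Inside each block an α-unimodal set is an initial segment, and each cut may
-- or may not belong to it: these coordinates identify U_α with a product of
-- chains of sizes α₁, 2, α₂, …, 2, α_ℓ (ChainDecomposition), which is the first
-- half of (vii) and, counting coordinates, gives (v).  Finally (-1)^|S| on the
-- subsets of S_α ∪ {k+1 : k ∈ S_α⁰} satisfies the recursion defining the
-- Möbius function (MobiusFunction).

open import Defs
open import Data.Nat using (ℕ)
open import Data.List using (List)
open import Data.Product using (_×_; _,_)

module SubsetsAsVectors where

  open import Defs using (_∈ₙ_)
  open import Data.Nat using (ℕ; zero; suc; _≤_; _<_; z≤n; s≤s)
  open import Data.Nat.Properties using (suc-injective)
  open import Data.Bool using (Bool; true; false; _∧_; _∨_)
  open import Data.Fin using (Fin; toℕ; zero; suc)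
  open import Data.Fin.Properties using (toℕ-injective; toℕ<n)
  open import Data.Fin.Subset using (Subset; _⊆_; ⊥)
  open import Data.Vec using (Vec; []; _∷_; zipWith; _[_]=_; here; there)
  open import Data.Product using (Σ; _×_; _,_)
  open import Data.Sum using (_⊎_; inj₁; inj₂)
  open import Data.Empty using (⊥-elim)
  open import Relation.Binary.PropositionalEquality

  false≢true : false ≢ true
  false≢true ()

  -- A Boolean vector v of length m is read as a subset of [m] = {1,…,m}:
  -- 'has v k' tells whether k belongs to it (positions 0 and > m never do).
  has : ∀ {m} → Vec Bool m → ℕ → Bool
  has []      k             = false
  has (b ∷ v) zero          = false
  has (b ∷ v) (suc zero)    = b
  has (b ∷ v) (suc (suc k)) = has v (suc k)

  fromPred : ∀ m → (ℕ → Bool) → Vec Bool m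
  fromPred zero    f = []
  fromPred (suc m) f = f 1 ∷ fromPred m (λ k → f (suc k))

  has-zero : ∀ {m} (v : Vec Bool m) → has v 0 ≡ false
  has-zero []      = refl
  has-zero (b ∷ v) = refl

  has-beyond : ∀ {m} (v : Vec Bool m) k → m < k → has v k ≡ false
  has-beyond []      k             _         = refl
  has-beyond (b ∷ v) (suc (suc k)) (s≤s m<k) = has-beyond v (suc k) m<k

  has-fromPred : ∀ m f k → 1 ≤ k → k ≤ m → has (fromPred m f) k ≡ f k
  has-fromPred (suc m) f (suc zero)    _ _         = refl
  has-fromPred (suc m) f (suc (suc k)) _ (s≤s k≤m) =
    has-fromPred m (λ k → f (suc k)) (suc k) (s≤s z≤n) k≤m

  fromPred-has : ∀ {m} (v : Vec Bool m) f → (∀ k → 1 ≤ k → k ≤ m → f k ≡ has v k) → fromPred m f ≡ v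
  fromPred-has []      f h = refl
  fromPred-has (b ∷ v) f h = cong₂ _∷_ (h 1 (s≤s z≤n) (s≤s z≤n))
    (fromPred-has v (λ k → f (suc k)) λ { (suc k) _ (s≤s k≤m) → h (suc (suc k)) (s≤s z≤n) (s≤s (s≤s k≤m)) })

  fromPred-cong : ∀ m {f g : ℕ → Bool} → (∀ k → 1 ≤ k → k ≤ m → f k ≡ g k) → fromPred m f ≡ fromPred m g
  fromPred-cong m {f} {g} f≡g =
    fromPred-has (fromPred m g) f λ k 1≤k k≤m → trans (f≡g k 1≤k k≤m) (sym (has-fromPred m g k 1≤k k≤m))

  has-injective : ∀ {m} (u v : Vec Bool m) → (∀ k → has u k ≡ has v k) → u ≡ v
  has-injective u v h = trans (sym (fromPred-has u (has v) λ k _ _ → sym (h k))) (fromPred-has v (has v) λ _ _ _ → refl)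

  has-true-bounds : ∀ {m} (v : Vec Bool m) k → has v k ≡ true → 1 ≤ k × k ≤ m
  has-true-bounds (true ∷ v) (suc zero)    _ = s≤s z≤n , s≤s z≤n
  has-true-bounds (b ∷ v)    (suc (suc k)) e with has-true-bounds v (suc k) e
  ... | _ , k≤m = s≤s z≤n , s≤s k≤m

  has⇒∈ₙ : ∀ {m} (S : Subset m) k → has S k ≡ true → k ∈ₙ S
  has⇒∈ₙ (true ∷ S) (suc zero)    refl = zero , refl , here
  has⇒∈ₙ (b ∷ S)    (suc (suc k)) e    with has⇒∈ₙ S (suc k) e
  ... | i , i≡k , i∈S = suc i , cong suc i≡k , there i∈S

  ∈ₙ⇒has : ∀ {m} (S : Subset m) k → k ∈ₙ S → has S k ≡ true
  ∈ₙ⇒has S _ (i , refl , i∈S) = has-lookup S i i∈S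
    where
      has-lookup : ∀ {m} (S : Vec Bool m) (i : Fin m) → S [ i ]= true → has S (suc (toℕ i)) ≡ true
      has-lookup (b ∷ S) zero    here        = refl
      has-lookup (b ∷ S) (suc i) (there i∈S) = has-lookup S i i∈S

  ∈ₙ-bounds : ∀ {m k} {S : Subset m} → k ∈ₙ S → 1 ≤ k × k ≤ m
  ∈ₙ-bounds (i , refl , _) = s≤s z≤n , toℕ<n i

  ⊆⇒has : ∀ {m} {T S : Subset m} → T ⊆ S → ∀ k → has T k ≡ true → has S k ≡ true
  ⊆⇒has {T = T} {S} T⊆S k e with has⇒∈ₙ T k e
  ... | i , refl , i∈T = ∈ₙ⇒has S k (i , refl , T⊆S i∈T)

  has⇒⊆ : ∀ {m} {T S : Subset m} → (∀ k → has T k ≡ true → has S k ≡ true) → T ⊆ S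
  has⇒⊆ {T = T} {S} h {i} i∈T with has⇒∈ₙ S _ (h _ (∈ₙ⇒has T _ (i , refl , i∈T)))
  ... | j , j≡i , j∈S with toℕ-injective (suc-injective j≡i)
  ... | refl = j∈S

  has-∨ : ∀ {m} (u v : Vec Bool m) k → has (zipWith _∨_ u v) k ≡ has u k ∨ has v k
  has-∨ []      []      k             = refl
  has-∨ (a ∷ u) (b ∷ v) zero          = refl
  has-∨ (a ∷ u) (b ∷ v) (suc zero)    = refl
  has-∨ (a ∷ u) (b ∷ v) (suc (suc k)) = has-∨ u v (suc k)

  has-∧ : ∀ {m} (u v : Vec Bool m) k → has (zipWith _∧_ u v) k ≡ has u k ∧ has v k
  has-∧ []      []      k             = refl
  has-∧ (a ∷ u) (b ∷ v) zero          = refl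
  has-∧ (a ∷ u) (b ∷ v) (suc zero)    = refl
  has-∧ (a ∷ u) (b ∷ v) (suc (suc k)) = has-∧ u v (suc k)

  has-⊥ : ∀ m k → has (⊥ {m}) k ≡ false
  has-⊥ zero    k             = refl
  has-⊥ (suc m) zero          = refl
  has-⊥ (suc m) (suc zero)    = refl
  has-⊥ (suc m) (suc (suc k)) = has-⊥ m (suc k)

  has-witness : ∀ {m} (v : Vec Bool m) → (Σ ℕ λ k → has v k ≡ true) ⊎ (∀ k → has v k ≡ false)
  has-witness []          = inj₂ λ _ → refl
  has-witness (true ∷ v)  = inj₁ (1 , refl)
  has-witness (false ∷ v) with has-witness v
  ... | inj₁ (zero  , e) = ⊥-elim (false≢true (trans (sym (has-zero v)) e))
  ... | inj₁ (suc k , e) = inj₁ (suc (suc k) , e)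
  ... | inj₂ none        = inj₂ λ { zero → refl ; (suc zero) → refl ; (suc (suc k)) → none (suc k) }

module Blocks where

  open import Defs
  open import Data.Nat
  open import Data.Nat.Properties
  open import Data.List using (List; []; _∷_; length)
  open import Data.Nat.ListAction using (sum)
  open import Data.List.Relation.Unary.All using (All; []; _∷_)
  open import Data.Product using (Σ; _×_; _,_)
  open import Data.Sum using (inj₁; inj₂)
  open import Data.Empty using (⊥-elim)
  open import Relation.Nullary using (¬_; yes; no)
  open import Relation.Binary.PropositionalEquality

  PositiveParts : List ℕ → Set
  PositiveParts = All (λ a → 1 ≤ a)

  pre-mono : ∀ {i j} α → i ≤ j → pre i α ≤ pre j α
  pre-mono {zero}          α       _         = z≤n
  pre-mono {suc i} {suc j} []      _         = ≤-refl
  pre-mono {suc i} {suc j} (a ∷ α) (s≤s i≤j) = +-monoʳ-≤ a (pre-mono α i≤j)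

  pre-beyond : ∀ α i → length α ≤ i → pre i α ≡ sum α
  pre-beyond []      zero    _         = refl
  pre-beyond []      (suc i) _         = refl
  pre-beyond (a ∷ α) (suc i) (s≤s ℓ≤i) = cong (a +_) (pre-beyond α i ℓ≤i)

  pre≤sum : ∀ α i → pre i α ≤ sum α
  pre≤sum α i with ≤-total i (length α)
  ... | inj₁ i≤ℓ = subst (pre i α ≤_) (pre-beyond α (length α) ≤-refl) (pre-mono α i≤ℓ)
  ... | inj₂ ℓ≤i = ≤-reflexive (pre-beyond α i ℓ≤i)

  block-of : ∀ {α x} → PositiveParts α → 1 ≤ x → x ≤ sum α → Σ ℕ λ i → InBlock α i x
  block-of {[]} _ 1≤x x≤0 = ⊥-elim (<-irrefl refl (≤-trans 1≤x x≤0))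
  block-of {a ∷ α} {x} (_ ∷ pos) 1≤x x≤s with x ≤? a
  ... | yes x≤a = 1 , ≤-refl , s≤s z≤n , 1≤x , subst (x ≤_) (sym (+-identityʳ a)) x≤a
  ... | no  x≰a with block-of {α} {x ∸ a} pos (m<n⇒0<n∸m a<x)
                       (subst (x ∸ a ≤_) (m+n∸m≡n a (sum α)) (∸-monoˡ-≤ a x≤s))
    where a<x = ≰⇒> x≰a
  ...   | suc i , _ , i≤ℓ , lower , upper =
    suc (suc i) , s≤s z≤n , s≤s i≤ℓ ,
    subst (a + pre i α <_) a+[x∸a]≡x (+-monoʳ-< a lower) ,
    subst (_≤ a + pre (suc i) α) a+[x∸a]≡x (+-monoʳ-≤ a upper)
    where
      a+[x∸a]≡x : a + (x ∸ a) ≡ x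
      a+[x∸a]≡x = m+[n∸m]≡n (<⇒≤ (≰⇒> x≰a))

  interior-not-cut : ∀ {α i z} → 1 ≤ i → pre (i ∸ 1) α < z → z < pre i α → ¬ z ∈S α
  interior-not-cut {α} {suc i} _ lower upper (j , _ , _ , refl) with j ≤? i
  ... | yes j≤i = <-irrefl refl (<-≤-trans lower (pre-mono α j≤i))
  ... | no  j≰i = <-irrefl refl (<-≤-trans upper (pre-mono α (≰⇒> j≰i)))

  same-block : ∀ {α x} → PositiveParts α → 1 ≤ x → suc x ≤ sum α → ¬ x ∈S α →
               Σ ℕ λ i → InBlock α i x × InBlock α i (suc x)
  same-block {α} {x} pos 1≤x x<n x∉S with block-of {α} {x} pos 1≤x (≤-trans (n≤1+n x) x<n)
  ... | i , 1≤i , i≤ℓ , lower , upper with m≤n⇒m<n∨m≡n upper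
  ...   | inj₁ x<pre = i , (1≤i , i≤ℓ , lower , upper) , (1≤i , i≤ℓ , m<n⇒m<1+n lower , x<pre)
  ...   | inj₂ x≡pre with m≤n⇒m<n∨m≡n i≤ℓ
  ...     | inj₁ i<ℓ  = ⊥-elim (x∉S (i , 1≤i , i<ℓ , x≡pre))
  ...     | inj₂ refl = ⊥-elim (<-irrefl refl
                          (≤-trans x<n (≤-reflexive (trans (sym (pre-beyond α (length α) ≤-refl)) (sym x≡pre)))))

  composition-of-zero : ∀ {α} → IsComposition 0 α → α ≡ []
  composition-of-zero {[]}    _                   = refl
  composition-of-zero {a ∷ α} ((1≤a ∷ _) , sum≡0) = ⊥-elim (<-irrefl (sym sum≡0) (≤-trans 1≤a (m≤m+n a (sum α))))

module Cuts where

  open import Defs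
  open Blocks
  open SubsetsAsVectors using (false≢true)
  open import Data.Nat
  open import Data.Nat.Properties
  open import Data.Bool using (Bool; true; false; _∧_; _∨_)
  open import Data.List using (List; []; _∷_)
  open import Data.Nat.ListAction using (sum)
  open import Data.List.Relation.Unary.All using (_∷_; head)
  open import Data.Product using (∃; _×_; _,_)
  open import Data.Sum using (_⊎_; inj₁; inj₂)
  open import Data.Empty using (⊥-elim)
  open import Relation.Nullary using (¬_; Dec; yes; no)
  open import Relation.Binary.PropositionalEquality
  open import Relation.Binary.Definitions using (tri<; tri≈; tri>)

  cutStep : ℕ → (ℕ → Bool) → ℕ → Bool
  cutStep a rest k = (k ≡ᵇ a) ∨ ((a <ᵇ k) ∧ rest (k ∸ a))

  isCut : List ℕ → ℕ → Bool
  isCut []           k = false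
  isCut (a ∷ [])     k = false
  isCut (a ∷ b ∷ as) k = cutStep a (isCut (b ∷ as)) k

  cutStep-below : ∀ a rest k → k < a → cutStep a rest k ≡ false
  cutStep-below (suc a) rest zero    _         = refl
  cutStep-below (suc a) rest (suc k) (s≤s k<a) = cutStep-below a rest k k<a

  cutStep-at : ∀ a rest → cutStep a rest a ≡ true
  cutStep-at zero    rest = refl
  cutStep-at (suc a) rest = cutStep-at a rest

  cutStep-above : ∀ a rest k → cutStep a rest (a + suc k) ≡ rest (suc k)
  cutStep-above zero    rest k = refl
  cutStep-above (suc a) rest k = cutStep-above a rest k

  cut-below : ∀ a b as k → k < a → isCut (a ∷ b ∷ as) k ≡ false
  cut-below a b as = cutStep-below a (isCut (b ∷ as))

  cut-at : ∀ a b as → isCut (a ∷ b ∷ as) a ≡ true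
  cut-at a b as = cutStep-at a (isCut (b ∷ as))

  cut-above : ∀ a b as k → 1 ≤ k → isCut (a ∷ b ∷ as) (a + k) ≡ isCut (b ∷ as) k
  cut-above a b as (suc k) _ = cutStep-above a (isCut (b ∷ as)) k

  ∈S-cons⁺ : ∀ {a b as k} → k ∈S (b ∷ as) → (a + k) ∈S (a ∷ b ∷ as)
  ∈S-cons⁺ (j , 1≤j , j<ℓ , refl) = suc j , s≤s z≤n , s≤s j<ℓ , refl

  head-∈S : ∀ a b as → a ∈S (a ∷ b ∷ as)
  head-∈S a b as = 1 , s≤s z≤n , s≤s (s≤s z≤n) , sym (+-identityʳ a)

  ∈S-cons⁻ : ∀ {a b as k} → 1 ≤ b → k ∈S (a ∷ b ∷ as) →
             k ≡ a ⊎ ∃ λ k' → 1 ≤ k' × k ≡ a + k' × k' ∈S (b ∷ as)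
  ∈S-cons⁻ {a} _ (suc zero , _ , _ , refl) = inj₁ (+-identityʳ a)
  ∈S-cons⁻ {a} {b} {as} 1≤b (suc (suc j) , _ , s≤s j<ℓ , refl) =
    inj₂ (b + pre j as , ≤-trans 1≤b (m≤m+n b _) , refl , suc j , s≤s z≤n , j<ℓ , refl)

  no-cuts-singleton : ∀ a k → ¬ k ∈S (a ∷ [])
  no-cuts-singleton a k (suc zero    , _ , s≤s () , _)
  no-cuts-singleton a k (suc (suc j) , _ , s≤s () , _)

  isCut⇒∈S : ∀ {α k} → PositiveParts α → isCut α k ≡ true → k ∈S α
  isCut⇒∈S {a ∷ b ∷ as} {k} (_ ∷ pos) e with <-cmp k a
  ... | tri< k<a _ _ = ⊥-elim (false≢true (trans (sym (cut-below a b as k k<a)) e))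
  ... | tri≈ _ refl _ = head-∈S a b as
  ... | tri> _ _ a<k  = subst (_∈S (a ∷ b ∷ as)) a+[k∸a]≡k
                          (∈S-cons⁺ (isCut⇒∈S pos (trans (sym (cut-above a b as (k ∸ a) (m<n⇒0<n∸m a<k)))
                                                     (subst (λ z → isCut (a ∷ b ∷ as) z ≡ true) (sym a+[k∸a]≡k) e))))
    where a+[k∸a]≡k = m+[n∸m]≡n (<⇒≤ a<k)

  ∈S⇒isCut : ∀ {α k} → PositiveParts α → k ∈S α → isCut α k ≡ true
  ∈S⇒isCut {a ∷ []}     _ k∈S = ⊥-elim (no-cuts-singleton a _ k∈S)
  ∈S⇒isCut {a ∷ b ∷ as} (_ ∷ pos) k∈S with ∈S-cons⁻ (head pos) k∈S
  ... | inj₁ refl                      = cut-at a b as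
  ... | inj₂ (k' , 1≤k' , refl , k'∈S) = trans (cut-above a b as k' 1≤k') (∈S⇒isCut pos k'∈S)

  _∈S?_ : ∀ {α} k → PositiveParts α → Dec (k ∈S α)
  _∈S?_ {α} k pos with isCut α k in e
  ... | true  = yes (isCut⇒∈S pos e)
  ... | false = no λ k∈S → ⊥-elim (false≢true (trans (sym e) (∈S⇒isCut pos k∈S)))

  ∈S-bounds : ∀ {α k} → PositiveParts α → k ∈S α → 1 ≤ k × suc k ≤ sum α
  ∈S-bounds {a ∷ []}     _ k∈S = ⊥-elim (no-cuts-singleton a _ k∈S)
  ∈S-bounds {a ∷ b ∷ as} (1≤a ∷ pos) k∈S with ∈S-cons⁻ (head pos) k∈S
  ... | inj₁ refl = 1≤a , subst (_≤ a + sum (b ∷ as)) (+-comm a 1) (+-monoʳ-≤ a (≤-trans (head pos) (m≤m+n b (sum as))))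
  ... | inj₂ (k' , 1≤k' , refl , k'∈S) with ∈S-bounds pos k'∈S
  ...   | _ , k'<n = ≤-trans 1≤k' (m≤n+m k' a) , subst (_≤ a + sum (b ∷ as)) (+-suc a k') (+-monoʳ-≤ a k'<n)

  before-first-cut : ∀ {a b as k} → 1 ≤ b → k < a → ¬ k ∈S (a ∷ b ∷ as)
  before-first-cut {a} 1≤b k<a k∈S with ∈S-cons⁻ 1≤b k∈S
  ... | inj₁ refl                  = <-irrefl refl k<a
  ... | inj₂ (k' , _ , refl , _)   = <-irrefl refl (<-≤-trans k<a (m≤m+n a k'))

  ∈S-unshift : ∀ {a b as x} → 1 ≤ b → 1 ≤ x → (a + x) ∈S (a ∷ b ∷ as) → x ∈S (b ∷ as)
  ∈S-unshift {a} 1≤b 1≤x a+x∈S with ∈S-cons⁻ 1≤b a+x∈S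
  ... | inj₁ a+x≡a = ⊥-elim (<-irrefl (sym (+-cancelˡ-≡ a _ 0 (trans a+x≡a (sym (+-identityʳ a))))) 1≤x)
  ... | inj₂ (k' , _ , a+x≡a+k' , k'∈S) = subst (_∈S _) (sym (+-cancelˡ-≡ a _ _ a+x≡a+k')) k'∈S

module LocalForm where

  open import Defs
  open Blocks
  open Cuts using (_∈S?_)
  open SubsetsAsVectors using (∈ₙ-bounds)
  open import Data.Nat
  open import Data.Nat.Properties
  open import Data.Fin.Subset using (_∪_; _∩_)
  open import Data.Fin.Subset.Properties using (x∈p∪q⁻; x∈p∪q⁺; x∈p∩q⁺; x∈p∩q⁻)
  open import Data.Fin.Properties using (toℕ-injective)
  open import Data.List using (List)
  open import Data.Product using (_,_; proj₁; proj₂)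
  open import Data.Sum using (_⊎_; inj₁; inj₂)
  open import Data.Empty using (⊥-elim)
  open import Relation.Nullary using (¬_; yes; no)
  open import Relation.Binary.PropositionalEquality

  LocalCondition : ℕ → List ℕ → (ℕ → Set) → Set
  LocalCondition n α P = ∀ x → 1 ≤ x → suc x ≤ n → ¬ x ∈S α → ¬ suc x ∈S α → P (suc x) → P x

  -- x and x+1 then lie in one block, where unimodality applies.
  unimodal⇒local : ∀ {n α P} → IsComposition n α → Unimodal α P → LocalCondition n α P
  unimodal⇒local (pos , refl) U x 1≤x x<n x∉S sx∉S Psx with same-block pos 1≤x x<n x∉S
  ... | i , x∈Bᵢ , sx∈Bᵢ = U i x (suc x) x∈Bᵢ sx∈Bᵢ x∉S sx∉S (n≤1+n x) Psx

  -- Conversely, walk down from y to x inside the block, one step at a time.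
  local⇒unimodal : ∀ {n α P} → IsComposition n α → LocalCondition n α P → Unimodal α P
  local⇒unimodal {α = α} {P} (_ , refl) L i x y x∈Bᵢ y∈Bᵢ _ y∉S x≤y Py = walk y y∈Bᵢ y∉S x≤y Py
    where
      lower : pre (i ∸ 1) α < x
      lower = proj₁ (proj₂ (proj₂ x∈Bᵢ))
      walk : ∀ y → InBlock α i y → ¬ y ∈S α → x ≤ y → P y → P x
      walk y _ _ x≤y Py with m≤n⇒m<n∨m≡n x≤y
      ... | inj₂ refl = Py
      walk (suc z) (1≤i , i≤ℓ , _ , upper) sz∉S _ Psz | inj₁ (s≤s x≤z) =
        walk z z∈Bᵢ z∉S x≤z (L z 1≤z (≤-trans upper (pre≤sum α i)) z∉S sz∉S Psz)
        where
          lower-z : pre (i ∸ 1) α < z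
          lower-z = <-≤-trans lower x≤z
          1≤z : 1 ≤ z
          1≤z = ≤-trans (s≤s z≤n) lower-z
          z∈Bᵢ : InBlock α i z
          z∈Bᵢ = 1≤i , i≤ℓ , lower-z , ≤-trans (n≤1+n z) upper
          z∉S : ¬ z ∈S α
          z∉S = interior-not-cut 1≤i lower-z upper

  -- Refining α only removes constraints from the local condition.
  local-refine : ∀ {n α β P} → Refines α β → LocalCondition n β P → LocalCondition n α P
  local-refine α≤β L x 1≤x x<n x∉Sα sx∉Sα = L x 1≤x x<n (λ p → x∉Sα (α≤β _ p)) (λ p → sx∉Sα (α≤β _ p))

  local-⊆S : ∀ {n α P} → (∀ k → P k → k ∈S α) → LocalCondition n α P
  local-⊆S P⊆S x _ _ _ sx∉S Psx = ⊥-elim (sx∉S (P⊆S (suc x) Psx))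

  unimodal-cong : ∀ {α P Q} → (∀ k → P k → Q k) → (∀ k → Q k → P k) → Unimodal α P → Unimodal α Q
  unimodal-cong P⇒Q Q⇒P U i x y x∈Bᵢ y∈Bᵢ x∉S y∉S x≤y Qy =
    P⇒Q x (U i x y x∈Bᵢ y∈Bᵢ x∉S y∉S x≤y (Q⇒P y Qy))

  partI : ∀ n α → IsComposition n α → PartI n α
  partI n α ic@(pos , _) S = fwd , bwd
    where
      fwd : InU α S → ∀ k → k ∈ₙ S → ¬ (k ∈S α) → (k ∸ 1) ∈ₙ S ⊎ (k ∸ 1) ∈S α ⊎ k ∸ 1 ≡ 0
      fwd u k k∈S k∉Sα with (k ∸ 1) ∈S? pos
      ... | yes p = inj₂ (inj₁ p)
      fwd u (suc zero)    k∈S k∉Sα | no _ = inj₂ (inj₂ refl)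
      fwd u (suc (suc x)) k∈S k∉Sα | no x∉Sα =
        inj₁ (unimodal⇒local ic u (suc x) (s≤s z≤n) (≤-trans (proj₂ (∈ₙ-bounds k∈S)) (m∸n≤m n 1))
                              x∉Sα k∉Sα k∈S)
      bwd : (∀ k → k ∈ₙ S → ¬ (k ∈S α) → (k ∸ 1) ∈ₙ S ⊎ (k ∸ 1) ∈S α ⊎ k ∸ 1 ≡ 0) → InU α S
      bwd c = local⇒unimodal ic λ x 1≤x _ x∉Sα sx∉Sα sx∈S → predecessor (c (suc x) sx∈S sx∉Sα) x∉Sα 1≤x
        where
          predecessor : ∀ {x} → x ∈ₙ S ⊎ x ∈S α ⊎ x ≡ 0 → ¬ x ∈S α → 1 ≤ x → x ∈ₙ S
          predecessor (inj₁ x∈S)          _    _  = x∈S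
          predecessor (inj₂ (inj₁ x∈Sα))  x∉Sα _  = ⊥-elim (x∉Sα x∈Sα)
          predecessor (inj₂ (inj₂ refl))  _    ()

  partII : ∀ n α β → IsComposition n α → IsComposition n β → PartII n α β
  partII n α β icα icβ α≤β S u = local⇒unimodal icα (local-refine α≤β (unimodal⇒local icβ u))

  partIII : ∀ n α β → IsComposition n α → PartIII α β
  partIII n α β icα α≤β = local⇒unimodal icα (local-⊆S {n} α≤β)

  partIV : ∀ n α → IsComposition n α → PartIV α
  partIV n α icα = local⇒unimodal icα (local-⊆S {n} λ _ p → p)

  -- (vi)  The local condition is preserved by unions and intersections.
  partVI : ∀ n α → IsComposition n α → PartVI n α
  partVI n α ic S T uS uT = local⇒unimodal ic union , local⇒unimodal ic intersection
    where
      LS = unimodal⇒local ic uS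
      LT = unimodal⇒local ic uT
      union : LocalCondition n α (_∈ₙ (S ∪ T))
      union x a b c d (i , e , i∈S∪T) with x∈p∪q⁻ S T i∈S∪T
      ... | inj₁ i∈S = let (j , e' , j∈S) = LS x a b c d (i , e , i∈S) in j , e' , x∈p∪q⁺ (inj₁ j∈S)
      ... | inj₂ i∈T = let (j , e' , j∈T) = LT x a b c d (i , e , i∈T) in j , e' , x∈p∪q⁺ (inj₂ j∈T)
      intersection : LocalCondition n α (_∈ₙ (S ∩ T))
      intersection x a b c d (i , e , i∈S∩T) with x∈p∩q⁻ S T i∈S∩T
      ... | i∈S , i∈T with LS x a b c d (i , e , i∈S) | LT x a b c d (i , e , i∈T)
      ...   | j , e₁ , j∈S | j' , e₂ , j'∈T with toℕ-injective (suc-injective (trans e₁ (sym e₂)))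
      ...     | refl = j , e₁ , x∈p∩q⁺ (j∈S , j'∈T)

module TransferForm where

  open import Defs
  open SubsetsAsVectors
  open Blocks
  open Cuts
  open LocalForm
  open import Data.Nat
  open import Data.Nat.Properties
  open import Data.Bool using (Bool; true; false; not; _∧_)
  open import Data.Bool.Properties using (∧-conicalˡ; ∧-conicalʳ; ¬-not)
  open import Data.Vec using (Vec; []; _∷_)
  open import Data.List using (List)
  open import Data.Fin.Subset using (Subset)
  open import Data.Product using (_,_; proj₁; proj₂)
  open import Data.Empty using (⊥-elim)
  open import Function.Bundles using (_⇔_; mk⇔; Equivalence)
  open import Relation.Binary.PropositionalEquality
  open import Relation.Nullary using (¬_; yes; no)

  -- The cut vector of α ⊨ m+1: the characteristic vector of S_α ⊆ [m].
  cuts : ∀ m → List ℕ → Vec Bool m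
  cuts m α = fromPred m (isCut α)

  LocalBool : ℕ → (ℕ → Bool) → (ℕ → Bool) → Set
  LocalBool m C S = ∀ x → 1 ≤ x → suc x ≤ m →
    C x ≡ false → C (suc x) ≡ false → S (suc x) ≡ true → S x ≡ true

  -- A transfer-matrix form of LocalBool, scanning the positions 1,…,m once.
  -- The state p says that the previous position was a non-cut outside s; a
  -- violation is a non-cut in s immediately after such a position.
  admissible : ∀ {m} → Bool → Vec Bool m → Vec Bool m → Bool
  admissible p []       []       = true
  admissible p (c ∷ cs) (s ∷ ss) = not (p ∧ not c ∧ s) ∧ admissible (not c ∧ not s) cs ss

  HeadOK : ∀ {m} → Bool → Vec Bool m → Vec Bool m → Set
  HeadOK p c s = p ≡ true → has c 1 ≡ false → has s 1 ≡ false

  private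
    violation : ∀ p s → not (p ∧ true ∧ s) ≡ true → p ≡ true → s ≡ false
    violation true false _ _ = refl

    no-violation : ∀ p c s → (p ≡ true → c ≡ false → s ≡ false) → not (p ∧ not c ∧ s) ≡ true
    no-violation false c     s     _ = refl
    no-violation true  true  s     _ = refl
    no-violation true  false false _ = refl
    no-violation true  false true  h with h refl refl
    ... | ()

  admissible⇒head : ∀ {m} p (c s : Vec Bool m) → admissible p c s ≡ true → HeadOK p c s
  admissible⇒head p []           []       _ _   _ = refl
  admissible⇒head p (true ∷ cs)  (s ∷ ss) _ _   ()
  admissible⇒head p (false ∷ cs) (s ∷ ss) h p≡t _ = violation p s (∧-conicalˡ _ _ h) p≡t

  admissible⇒local : ∀ {m} p (c s : Vec Bool m) → admissible p c s ≡ true → LocalBool m (has c) (has s)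
  admissible⇒local p (false ∷ c' ∷ cs) (s ∷ s' ∷ ss) h (suc zero) _ _ refl c'≡f s'≡t with s
  ... | true  = refl
  ... | false = ⊥-elim (false≢true (trans (sym s'≡f) s'≡t))
    where s'≡f = admissible⇒head true (c' ∷ cs) (s' ∷ ss) (∧-conicalʳ (not (p ∧ false)) _ h) refl c'≡f
  admissible⇒local p (c ∷ cs) (s ∷ ss) h (suc (suc x)) _ (s≤s x<m) =
    admissible⇒local (not c ∧ not s) cs ss (∧-conicalʳ _ _ h) (suc x) (s≤s z≤n) x<m

  local⇒head : ∀ {m} c s (cs ss : Vec Bool m) → LocalBool (suc m) (has (c ∷ cs)) (has (s ∷ ss)) →
               HeadOK (not c ∧ not s) cs ss
  local⇒head true  s     cs        ss        L () _
  local⇒head false true  cs        ss        L () _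
  local⇒head false false []        []        L _  _    = refl
  local⇒head false false (c' ∷ cs) (s' ∷ ss) L _  c'≡f =
    ¬-not λ s'≡t → false≢true (L 1 (s≤s z≤n) (s≤s (s≤s z≤n)) refl c'≡f s'≡t)

  local⇒admissible : ∀ {m} p (c s : Vec Bool m) → HeadOK p c s → LocalBool m (has c) (has s) → admissible p c s ≡ true
  local⇒admissible p []       []       _    _ = refl
  local⇒admissible p (c ∷ cs) (s ∷ ss) head L
    rewrite no-violation p c s head = local⇒admissible (not c ∧ not s) cs ss (local⇒head c s cs ss L) L'
    where
      L' : LocalBool _ (has cs) (has ss)
      L' (suc x) _ (s≤s x<m) = L (suc (suc x)) (s≤s z≤n) (s≤s (s≤s x<m))

  admissible⇔local : ∀ {m} (c s : Vec Bool m) → admissible false c s ≡ true ⇔ LocalBool m (has c) (has s)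
  admissible⇔local c s = mk⇔ (admissible⇒local false c s) (local⇒admissible false c s (λ ()))

  has-cuts : ∀ {m α} → IsComposition (suc m) α → ∀ k → has (cuts m α) k ≡ isCut α k
  has-cuts {m} {α} (pos , sum≡) k with isCut α k in e
  ... | true  = let (1≤k , k<n) = ∈S-bounds pos (isCut⇒∈S pos e) in
                trans (has-fromPred m (isCut α) k 1≤k (≤-pred (subst (suc k ≤_) sum≡ k<n))) e
  ... | false with 1 ≤? k | k ≤? m
  ...   | yes 1≤k | yes k≤m = trans (has-fromPred m (isCut α) k 1≤k k≤m) e
  ...   | no  1≰k | _       = subst (λ z → has (cuts m α) z ≡ false) (sym (n<1⇒n≡0 (≰⇒> 1≰k))) (has-zero (cuts m α))
  ...   | yes _   | no  k≰m = has-beyond (cuts m α) k (≰⇒> k≰m)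

  has-cuts⇒∈S : ∀ {m α} → IsComposition (suc m) α → ∀ k → has (cuts m α) k ≡ true → k ∈S α
  has-cuts⇒∈S ic k e = isCut⇒∈S (proj₁ ic) (trans (sym (has-cuts ic k)) e)

  ∈S⇒has-cuts : ∀ {m α} → IsComposition (suc m) α → ∀ k → k ∈S α → has (cuts m α) k ≡ true
  ∈S⇒has-cuts ic k k∈S = trans (has-cuts ic k) (∈S⇒isCut (proj₁ ic) k∈S)

  ∉S⇒has-cuts : ∀ {m α} → IsComposition (suc m) α → ∀ k → ¬ k ∈S α → has (cuts m α) k ≡ false
  ∉S⇒has-cuts ic k k∉S = ¬-not λ e → k∉S (has-cuts⇒∈S ic k e)

  unimodal⇔admissible : ∀ {m α} (P : ℕ → Set) (s : Vec Bool m) → IsComposition (suc m) α →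
    (∀ k → P k → has s k ≡ true) → (∀ k → has s k ≡ true → P k) →
    Unimodal α P ⇔ admissible false (cuts m α) s ≡ true
  unimodal⇔admissible {m} {α} P s ic P⇒s s⇒P =
    mk⇔ (λ U → Equivalence.from (admissible⇔local (cuts m α) s) (toBool (unimodal⇒local ic U)))
        (λ A → local⇒unimodal ic (fromBool (Equivalence.to (admissible⇔local (cuts m α) s) A)))
    where
      toBool : LocalCondition (suc m) α P → LocalBool m (has (cuts m α)) (has s)
      toBool L x 1≤x x<m cx csx ssx =
        P⇒s x (L x 1≤x (≤-trans x<m (n≤1+n m)) (λ p → false≢true (trans (sym cx) (∈S⇒has-cuts ic x p)))
                 (λ p → false≢true (trans (sym csx) (∈S⇒has-cuts ic (suc x) p))) (s⇒P (suc x) ssx))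
      fromBool : LocalBool m (has (cuts m α)) (has s) → LocalCondition (suc m) α P
      fromBool L x 1≤x _ x∉S sx∉S Psx =
        s⇒P x (L x 1≤x (proj₂ (has-true-bounds s (suc x) (P⇒s (suc x) Psx)))
                   (∉S⇒has-cuts ic x x∉S) (∉S⇒has-cuts ic (suc x) sx∉S) (P⇒s (suc x) Psx))

  inU⇔admissible : ∀ {m α} → IsComposition (suc m) α → (S : Subset m) →
    InU α S ⇔ admissible false (cuts m α) S ≡ true
  inU⇔admissible ic S = unimodal⇔admissible (_∈ₙ S) S ic (∈ₙ⇒has S) (has⇒∈ₙ S)

  cutsUnimodal⇔admissible : ∀ {m α β} → IsComposition (suc m) α → IsComposition (suc m) β →
    Unimodal α (_∈S β) ⇔ admissible false (cuts m α) (cuts m β) ≡ true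
  cutsUnimodal⇔admissible icα icβ = unimodal⇔admissible _ _ icα (∈S⇒has-cuts icβ) (has-cuts⇒∈S icβ)

module Enumeration where

  open import Defs using (sumℤ; Enumerates)
  open import Data.Nat using (ℕ; zero; suc; _+_)
  open import Data.Nat.Properties using (+-identityʳ; +-assoc)
  open import Data.Integer using (ℤ; +_) renaming (_+_ to _+ℤ_; _*_ to _*ℤ_; _-_ to _-ℤ_)
  import Data.Integer.Properties as ℤ
  open import Data.Integer.Tactic.RingSolver using (solve-∀)
  open import Data.Bool using (Bool; true; false; if_then_else_; _≟_)
  open import Data.Vec using (Vec; []; _∷_)
  open import Data.List using (List; []; _∷_; _++_; map; filter; length)
  open import Data.List.Properties using (map-++; map-∘; map-cong-local)
  open import Data.List.Membership.Propositional using (_∈_; _∉_)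
  open import Data.List.Membership.Propositional.Properties
    using (∈-map⁺; ∈-map⁻; ∈-++⁺ˡ; ∈-++⁺ʳ; ∈-++⁻; ∈-∃++; ∈-filter⁺; ∈-filter⁻)
  open import Data.List.Relation.Unary.Any using (here; there)
  open import Data.List.Relation.Unary.All using (All; []; _∷_; tabulate)
  open import Data.List.Relation.Unary.All.Properties using (++⁻; ++⁺)
  open import Data.List.Relation.Unary.AllPairs using ([]; _∷_)
  open import Data.List.Relation.Unary.Unique.Propositional using (Unique)
  import Data.List.Relation.Unary.Unique.Propositional.Properties as Unique
  open import Data.Product using (_×_; _,_; proj₁; proj₂)
  open import Data.Sum using (inj₁; inj₂)
  open import Data.Empty using (⊥-elim)
  open import Function using (_∘_)
  open import Function.Bundles using (_⇔_; Equivalence)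
  open import Relation.Nullary using (¬_; Dec)
  open import Relation.Binary.PropositionalEquality

  allVec : ∀ m → List (Vec Bool m)
  allVec zero    = [] ∷ []
  allVec (suc m) = map (true ∷_) (allVec m) ++ map (false ∷_) (allVec m)

  allVec-complete : ∀ {m} (v : Vec Bool m) → v ∈ allVec m
  allVec-complete []                  = here refl
  allVec-complete {suc m} (true ∷ v)  = ∈-++⁺ˡ (∈-map⁺ (true ∷_) (allVec-complete v))
  allVec-complete {suc m} (false ∷ v) = ∈-++⁺ʳ (map (true ∷_) (allVec m)) (∈-map⁺ (false ∷_) (allVec-complete v))

  allVec-unique : ∀ m → Unique (allVec m)
  allVec-unique zero    = [] ∷ []
  allVec-unique (suc m) =
    Unique.++⁺ (Unique.map⁺ ∷-injective (allVec-unique m)) (Unique.map⁺ ∷-injective (allVec-unique m)) disjoint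
    where
      ∷-injective : ∀ {b} {x y : Vec Bool m} → b ∷ x ≡ b ∷ y → x ≡ y
      ∷-injective refl = refl
      disjoint : ∀ {v} → ¬ (v ∈ map (true ∷_) (allVec m) × v ∈ map (false ∷_) (allVec m))
      disjoint (p , q) with ∈-map⁻ (true ∷_) p | ∈-map⁻ (false ∷_) q
      ... | _ , _ , refl | _ , _ , ()

  holds? : ∀ {A : Set} (f : A → Bool) x → Dec (f x ≡ true)
  holds? f x = f x ≟ true

  select : ∀ {A : Set} → (A → Bool) → List A → List A
  select f = filter (holds? f)

  Σᴺ : ∀ m → (Vec Bool m → ℕ) → ℕ
  Σᴺ zero    g = g []
  Σᴺ (suc m) g = Σᴺ m (g ∘ (true ∷_)) + Σᴺ m (g ∘ (false ∷_))

  Σᶻ : ∀ m → (Vec Bool m → ℤ) → ℤ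
  Σᶻ zero    g = g []
  Σᶻ (suc m) g = Σᶻ m (g ∘ (true ∷_)) +ℤ Σᶻ m (g ∘ (false ∷_))

  indicator : Bool → ℕ
  indicator true  = 1
  indicator false = 0

  Σᴺ-zero : ∀ m → Σᴺ m (λ _ → 0) ≡ 0
  Σᴺ-zero zero    = refl
  Σᴺ-zero (suc m) = cong₂ _+_ (Σᴺ-zero m) (Σᴺ-zero m)

  count-select : ∀ m (f : Vec Bool m → Bool) → length (select f (allVec m)) ≡ Σᴺ m (indicator ∘ f)
  count-select m f = trans (length-select (allVec m)) (sum-allVec m (indicator ∘ f))
    where
      sumMap : ∀ {A : Set} → (A → ℕ) → List A → ℕ
      sumMap g = Data.List.foldr (λ x r → g x + r) 0
      length-select : ∀ {A : Set} {f : A → Bool} xs → length (select f xs) ≡ sumMap (indicator ∘ f) xs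
      length-select [] = refl
      length-select {f = f} (x ∷ xs) with f x
      ... | true  = cong suc (length-select xs)
      ... | false = length-select xs
      sumMap-++ : ∀ {A : Set} (g : A → ℕ) xs ys → sumMap g (xs ++ ys) ≡ sumMap g xs + sumMap g ys
      sumMap-++ g []       ys = refl
      sumMap-++ g (x ∷ xs) ys = trans (cong (_+_ (g x)) (sumMap-++ g xs ys)) (sym (+-assoc (g x) _ _))
      sumMap-map : ∀ {A B : Set} (g : B → ℕ) (h : A → B) xs → sumMap g (map h xs) ≡ sumMap (g ∘ h) xs
      sumMap-map g h []       = refl
      sumMap-map g h (x ∷ xs) = cong (_+_ (g (h x))) (sumMap-map g h xs)
      sum-allVec : ∀ m (g : Vec Bool m → ℕ) → sumMap g (allVec m) ≡ Σᴺ m g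
      sum-allVec zero    g = +-identityʳ (g [])
      sum-allVec (suc m) g =
        trans (sumMap-++ g (map (true ∷_) (allVec m)) (map (false ∷_) (allVec m)))
          (cong₂ _+_ (trans (sumMap-map g (true ∷_) (allVec m)) (sum-allVec m _))
                     (trans (sumMap-map g (false ∷_) (allVec m)) (sum-allVec m _)))

  Σᶻ-cong : ∀ m {g h : Vec Bool m → ℤ} → (∀ v → g v ≡ h v) → Σᶻ m g ≡ Σᶻ m h
  Σᶻ-cong zero    e = e []
  Σᶻ-cong (suc m) e = cong₂ _+ℤ_ (Σᶻ-cong m (e ∘ (true ∷_))) (Σᶻ-cong m (e ∘ (false ∷_)))

  Σᶻ-zero : ∀ m → Σᶻ m (λ _ → + 0) ≡ + 0
  Σᶻ-zero zero    = refl
  Σᶻ-zero (suc m) = cong₂ _+ℤ_ (Σᶻ-zero m) (Σᶻ-zero m)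

  Σᶻ-+ : ∀ m (g h : Vec Bool m → ℤ) → Σᶻ m (λ v → g v +ℤ h v) ≡ Σᶻ m g +ℤ Σᶻ m h
  Σᶻ-+ zero    g h = refl
  Σᶻ-+ (suc m) g h =
    trans (cong₂ _+ℤ_ (Σᶻ-+ m (g ∘ (true ∷_)) (h ∘ (true ∷_))) (Σᶻ-+ m (g ∘ (false ∷_)) (h ∘ (false ∷_))))
          (interchange (Σᶻ m (g ∘ (true ∷_))) (Σᶻ m (h ∘ (true ∷_)))
                       (Σᶻ m (g ∘ (false ∷_))) (Σᶻ m (h ∘ (false ∷_))))
    where
      interchange : ∀ a b c d → (a +ℤ b) +ℤ (c +ℤ d) ≡ (a +ℤ c) +ℤ (b +ℤ d)
      interchange = solve-∀

  Σᶻ-* : ∀ m a (g : Vec Bool m → ℤ) → Σᶻ m (λ v → a *ℤ g v) ≡ a *ℤ Σᶻ m g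
  Σᶻ-* zero    a g = refl
  Σᶻ-* (suc m) a g =
    trans (cong₂ _+ℤ_ (Σᶻ-* m a (g ∘ (true ∷_))) (Σᶻ-* m a (g ∘ (false ∷_)))) (sym (ℤ.*-distribˡ-+ a _ _))

  sumℤ-++ : ∀ xs ys → sumℤ (xs ++ ys) ≡ sumℤ xs +ℤ sumℤ ys
  sumℤ-++ []       ys = sym (ℤ.+-identityˡ (sumℤ ys))
  sumℤ-++ (x ∷ xs) ys = trans (cong (x +ℤ_) (sumℤ-++ xs ys)) (sym (ℤ.+-assoc x _ _))

  sumℤ-allVec : ∀ m (g : Vec Bool m → ℤ) → sumℤ (map g (allVec m)) ≡ Σᶻ m g
  sumℤ-allVec zero    g = ℤ.+-identityʳ (g [])
  sumℤ-allVec (suc m) g =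
    trans (cong sumℤ (map-++ g (map (true ∷_) (allVec m)) (map (false ∷_) (allVec m))))
      (trans (sumℤ-++ (map g (map (true ∷_) (allVec m))) (map g (map (false ∷_) (allVec m))))
        (cong₂ _+ℤ_ (trans (cong sumℤ (sym (map-∘ (allVec m)))) (sumℤ-allVec m _))
                    (trans (cong sumℤ (sym (map-∘ (allVec m)))) (sumℤ-allVec m _))))

  sumℤ-select : ∀ m (f : Vec Bool m → Bool) (w : Vec Bool m → ℤ) →
    sumℤ (map w (select f (allVec m))) ≡ Σᶻ m (λ v → if f v then w v else + 0)
  sumℤ-select m f w = trans (sum-select (allVec m)) (sumℤ-allVec m _)
    where
      sum-select : ∀ xs → sumℤ (map w (select f xs)) ≡ sumℤ (map (λ v → if f v then w v else + 0) xs)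
      sum-select []       = refl
      sum-select (x ∷ xs) with f x
      ... | true  = cong (w x +ℤ_) (sum-select xs)
      ... | false = trans (sum-select xs) (sym (ℤ.+-identityˡ _))

  module _ {A : Set} where

    private
      all-∈ : ∀ {P : A → Set} {xs x} → All P xs → x ∈ xs → P x
      all-∈ (p ∷ _)  (here refl) = p
      all-∈ (_ ∷ ps) (there x∈)  = all-∈ ps x∈

    unique-remove : ∀ (xs : List A) x ys → Unique (xs ++ x ∷ ys) → Unique (xs ++ ys) × x ∉ xs ++ ys
    unique-remove []       x ys (x∉ys ∷ u) = u , λ p → all-∈ x∉ys p refl
    unique-remove (a ∷ xs) x ys (a∉ ∷ u) with unique-remove xs x ys u | ++⁻ xs a∉
    ... | u' , x∉ | a∉xs , (a≢x ∷ a∉ys) = (++⁺ a∉xs a∉ys ∷ u') , λ { (here refl) → a≢x refl ; (there p) → x∉ p }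

    ∈-remove : ∀ (xs : List A) {x y} ys → y ∈ xs ++ ys → y ∈ xs ++ x ∷ ys
    ∈-remove xs ys p with ∈-++⁻ xs p
    ... | inj₁ q = ∈-++⁺ˡ q
    ... | inj₂ q = ∈-++⁺ʳ xs (there q)

    sumℤ-remove : ∀ (f : A → ℤ) xs x ys → sumℤ (map f (xs ++ x ∷ ys)) ≡ f x +ℤ sumℤ (map f (xs ++ ys))
    sumℤ-remove f []       x ys = refl
    sumℤ-remove f (a ∷ xs) x ys =
      trans (cong (f a +ℤ_) (sumℤ-remove f xs x ys)) (swap (f a) (f x) _)
      where
        swap : ∀ a b c → a +ℤ (b +ℤ c) ≡ b +ℤ (a +ℤ c)
        swap = solve-∀

    sumℤ-enumeration : ∀ (f : A → ℤ) (L₁ L₂ : List A) → Unique L₁ → Unique L₂ →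
      (∀ x → x ∈ L₁ → x ∈ L₂) → (∀ x → x ∈ L₂ → x ∈ L₁) → sumℤ (map f L₁) ≡ sumℤ (map f L₂)
    sumℤ-enumeration f []       []       _ _ _ _ = refl
    sumℤ-enumeration f []       (y ∷ L₂) _ _ _ from with from y (here refl)
    ... | ()
    sumℤ-enumeration f (x ∷ L₁) L₂ (x∉L₁ ∷ u₁) u₂ to from with ∈-∃++ (to x (here refl))
    ... | ys , zs , refl with unique-remove ys x zs u₂
    ...   | u' , x∉ = trans (cong (f x +ℤ_) (sumℤ-enumeration f L₁ (ys ++ zs) u₁ u' to' from'))
                            (sym (sumℤ-remove f ys x zs))
      where
        to' : ∀ y → y ∈ L₁ → y ∈ ys ++ zs
        to' y p with ∈-++⁻ ys (to y (there p))
        ... | inj₁ q          = ∈-++⁺ˡ q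
        ... | inj₂ (here refl) = ⊥-elim (all-∈ x∉L₁ p refl)
        ... | inj₂ (there q)  = ∈-++⁺ʳ ys q
        from' : ∀ y → y ∈ ys ++ zs → y ∈ L₁
        from' y p with from y (∈-remove ys zs p)
        ... | here refl = ⊥-elim (x∉ p)
        ... | there q   = q

  sumℤ-enumerated : ∀ m (P : Vec Bool m → Set) (f : Vec Bool m → Bool) → (∀ v → P v ⇔ f v ≡ true) →
    ∀ L → Enumerates P L → ∀ w → sumℤ (map w L) ≡ Σᶻ m (λ v → if f v then w v else + 0)
  sumℤ-enumerated m P f P⇔f L (uL , sound , complete) w =
    trans (sumℤ-enumeration w L (select f (allVec m)) uL (Unique.filter⁺ (holds? f) (allVec-unique m)) to from)
          (sumℤ-select m f w)
    where
      to : ∀ v → v ∈ L → v ∈ select f (allVec m)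
      to v v∈L = ∈-filter⁺ (holds? f) (allVec-complete v) (Equivalence.to (P⇔f v) (sound v v∈L))
      from : ∀ v → v ∈ select f (allVec m) → v ∈ L
      from v v∈ = complete v (Equivalence.from (P⇔f v) (proj₂ (∈-filter⁻ (holds? f) {xs = allVec m} v∈)))

  sumℤ-determines : ∀ {A : Set} (f g : A → ℤ) L x → Unique L → x ∈ L → (∀ y → y ∈ L → y ≢ x → f y ≡ g y) →
                    sumℤ (map f L) ≡ + 0 → sumℤ (map g L) ≡ + 0 → f x ≡ g x
  sumℤ-determines f g L x uL x∈L agree sumf sumg with ∈-∃++ x∈L
  ... | ys , zs , refl with unique-remove ys x zs uL
  ...   | _ , x∉ = cancel (f x) (g x) (sumℤ (map f (ys ++ zs)))
                     (trans (sym (sumℤ-remove f ys x zs)) sumf)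
                     (trans (cong (g x +ℤ_) rest) (trans (sym (sumℤ-remove g ys x zs)) sumg))
    where
      rest : sumℤ (map f (ys ++ zs)) ≡ sumℤ (map g (ys ++ zs))
      rest = cong sumℤ (map-cong-local (tabulate
               λ {y} y∈ → agree y (∈-remove ys zs y∈) λ { refl → x∉ y∈ }))
      cancel : ∀ a b s → a +ℤ s ≡ + 0 → b +ℤ s ≡ + 0 → a ≡ b
      cancel a b s a+s≡0 b+s≡0 = trans (undo a s) (trans (cong (_-ℤ s) (trans a+s≡0 (sym b+s≡0))) (sym (undo b s)))
        where undo : ∀ a s → a ≡ (a +ℤ s) -ℤ s
              undo = solve-∀

  filter-enumerates : ∀ {A : Set} {P Q : A → Set} {L} → Enumerates P L → (Q? : ∀ x → Dec (Q x)) →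
    Enumerates (λ x → P x × Q x) (filter Q? L)
  filter-enumerates {L = L} (uL , sound , complete) Q? =
    Unique.filter⁺ Q? uL ,
    (λ x x∈ → let p = ∈-filter⁻ Q? {xs = L} x∈ in sound x (proj₁ p) , proj₂ p) ,
    (λ x p → ∈-filter⁺ Q? (complete x (proj₁ p)) (proj₂ p))

module CutVectors where

  open import Defs
  open SubsetsAsVectors
  open Blocks
  open Cuts
  open TransferForm
  open import Data.Nat
  open import Data.Nat.Properties
  open import Data.Bool using (Bool; true; false)
  open import Data.Bool.Properties using (¬-not)
  open import Data.Vec using (Vec; []; _∷_)
  open import Data.List using (List; []; _∷_; map; length)
  open import Data.List.Properties using (map-∘)
  open import Data.Fin.Subset using (∣_∣)
  open import Data.Integer using (ℤ)
  open import Data.List.Membership.Propositional using (_∈_)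
  open import Data.List.Membership.Propositional.Properties using (∈-map⁺; ∈-map⁻; ∈-filter⁺; ∈-filter⁻)
  import Data.List.Relation.Unary.Unique.Propositional.Properties as Unique
  open import Function.Bundles using (_⇔_; Equivalence)
  open Enumeration
  open import Data.Nat.ListAction using (sum)
  open import Data.List.Relation.Unary.All using ([]; _∷_)
  open import Data.Product using (_×_; _,_; proj₁; proj₂)
  open import Data.Empty using (⊥-elim)
  open import Relation.Binary.PropositionalEquality
  open import Relation.Binary.Definitions using (tri<; tri≈; tri>)

  -- Decoding a cut vector into a composition: 'runs acc v' reads v as the cut
  -- pattern of a composition whose current part has already length acc.
  runs : ∀ {m} → ℕ → Vec Bool m → List ℕ
  runs acc []          = acc ∷ []
  runs acc (true ∷ v)  = acc ∷ runs 1 v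
  runs acc (false ∷ v) = runs (suc acc) v

  toComp : ∀ {m} → Vec Bool m → List ℕ
  toComp = runs 1

  runs-composition : ∀ {m} acc (v : Vec Bool m) → 1 ≤ acc → IsComposition (acc + m) (runs acc v)
  runs-composition acc []          1≤acc = (1≤acc ∷ []) , refl
  runs-composition {suc m} acc (true ∷ v) 1≤acc with runs-composition 1 v (s≤s z≤n)
  ... | pos , sum≡ = (1≤acc ∷ pos) , cong (acc +_) sum≡
  runs-composition {suc m} acc (false ∷ v) 1≤acc with runs-composition (suc acc) v (s≤s z≤n)
  ... | pos , sum≡ = pos , trans sum≡ (sym (+-suc acc m))

  toComp-composition : ∀ {m} (v : Vec Bool m) → IsComposition (suc m) (toComp v)
  toComp-composition v = runs-composition 1 v (s≤s z≤n)

  -- runs never returns the empty list, so isCut (a ∷ runs …) unfolds one step.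
  isCut-cons-runs : ∀ {m} a acc (v : Vec Bool m) k → isCut (a ∷ runs acc v) k ≡ cutStep a (isCut (runs acc v)) k
  isCut-cons-runs a acc []          k = refl
  isCut-cons-runs a acc (true ∷ v)  k = refl
  isCut-cons-runs a acc (false ∷ v) k = isCut-cons-runs a (suc acc) v k

  has-false-cons : ∀ {m} (v : Vec Bool m) i → has (false ∷ v) i ≡ has v (i ∸ 1)
  has-false-cons v zero          = sym (has-zero v)
  has-false-cons v (suc zero)    = sym (has-zero v)
  has-false-cons v (suc (suc i)) = refl

  isCut-runs : ∀ {m} a (v : Vec Bool m) j → isCut (runs (suc a) v) j ≡ has v (j ∸ a)
  isCut-runs a []          j = refl
  isCut-runs a (false ∷ v) j =
    trans (isCut-runs (suc a) v j)
          (trans (cong (has v) (sym (trans (∸-+-assoc j a 1) (cong (j ∸_) (+-comm a 1))))) (sym (has-false-cons v (j ∸ a))))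
  isCut-runs a (true ∷ v)  j with <-cmp j (suc a)
  ... | tri< j<sa _ _ = trans (isCut-cons-runs (suc a) 1 v j)
                          (trans (cutStep-below (suc a) (isCut (runs 1 v)) j j<sa)
                                 (cong (has (true ∷ v)) (sym (m≤n⇒m∸n≡0 (≤-pred j<sa)))))
  ... | tri≈ _ refl _ = trans (isCut-cons-runs (suc a) 1 v (suc a))
                          (trans (cutStep-at (suc a) (isCut (runs 1 v)))
                                 (cong (has (true ∷ v)) (sym (trans (cong (_∸ a) (+-comm 1 a)) (m+n∸m≡n a 1)))))
  ... | tri> _ _ sa<j = subst (λ z → isCut (runs (suc a) (true ∷ v)) z ≡ has (true ∷ v) (z ∸ a)) j≡ above
    where
      k = j ∸ suc (suc a)
      j≡ : suc a + suc k ≡ j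
      j≡ = trans (+-suc (suc a) k) (m+[n∸m]≡n sa<j)
      above : isCut (runs (suc a) (true ∷ v)) (suc a + suc k) ≡ has (true ∷ v) (suc a + suc k ∸ a)
      above = trans (isCut-cons-runs (suc a) 1 v (suc a + suc k))
                (trans (cutStep-above (suc a) (isCut (runs 1 v)) k)
                  (trans (isCut-runs 0 v (suc k))
                    (cong (has (true ∷ v)) (sym (trans (cong (_∸ a) (sym (+-suc a (suc k)))) (m+n∸m≡n a (suc (suc k))))))))

  cuts-toComp : ∀ {m} (v : Vec Bool m) → cuts m (toComp v) ≡ v
  cuts-toComp v = fromPred-has v (isCut (toComp v)) (λ k _ _ → isCut-runs 0 v k)

  isCut-zero : ∀ {α} → PositiveParts α → isCut α 0 ≡ false
  isCut-zero pos = ¬-not λ e → <-irrefl refl (proj₁ (∈S-bounds pos (isCut⇒∈S pos e)))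

  first-cut : ∀ c c' cs x → isCut (c ∷ c' ∷ cs) x ≡ true → c ≤ x
  first-cut c c' cs x e = ≮⇒≥ λ x<c → false≢true (trans (sym (cut-below c c' cs x x<c)) e)

  composition-determined : ∀ {α β} → PositiveParts α → PositiveParts β → sum α ≡ sum β →
                           (∀ k → isCut α k ≡ isCut β k) → α ≡ β
  composition-determined {[]}     {[]}     _ _ _ _ = refl
  composition-determined {[]}     {b ∷ bs} _ (1≤b ∷ _) sum≡ _ = ⊥-elim (<-irrefl sum≡ (≤-trans 1≤b (m≤m+n b (sum bs))))
  composition-determined {a ∷ as} {[]}     (1≤a ∷ _) _ sum≡ _ =
    ⊥-elim (<-irrefl (sym sum≡) (≤-trans 1≤a (m≤m+n a (sum as))))
  composition-determined {a ∷ []} {b ∷ []} _ _ sum≡ _ = cong (_∷ []) (trans (sym (+-identityʳ a)) (trans sum≡ (+-identityʳ b)))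
  composition-determined {a ∷ []} {b ∷ b' ∷ bs} _ _ _ cut≡ = ⊥-elim (false≢true (trans (cut≡ b) (cut-at b b' bs)))
  composition-determined {a ∷ a' ∷ as} {b ∷ []} _ _ _ cut≡ = ⊥-elim (false≢true (trans (sym (cut≡ a)) (cut-at a a' as)))
  composition-determined {a ∷ a' ∷ as} {b ∷ b' ∷ bs} (_ ∷ posα) (_ ∷ posβ) sum≡ cut≡
    with ≤-antisym (first-cut a a' as b (trans (cut≡ b) (cut-at b b' bs)))
                   (first-cut b b' bs a (trans (sym (cut≡ a)) (cut-at a a' as)))
  ... | refl = cong (a ∷_) (composition-determined posα posβ (+-cancelˡ-≡ a _ _ sum≡) tail≡)
    where
      tail≡ : ∀ k → isCut (a' ∷ as) k ≡ isCut (b' ∷ bs) k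
      tail≡ zero    = trans (isCut-zero posα) (sym (isCut-zero posβ))
      tail≡ (suc k) = trans (sym (cut-above a a' as (suc k) (s≤s z≤n)))
                            (trans (cut≡ (a + suc k)) (cut-above a b' bs (suc k) (s≤s z≤n)))

  toComp-cuts : ∀ {m α} → IsComposition (suc m) α → toComp (cuts m α) ≡ α
  toComp-cuts {m} {α} ic@(pos , sum≡) =
    composition-determined (proj₁ icT) pos (trans (proj₂ icT) (sym sum≡))
      (λ k → trans (isCut-runs 0 (cuts m α) k) (has-cuts ic k))
    where icT = toComp-composition (cuts m α)

  toComp-injective : ∀ {m} {c d : Vec Bool m} → toComp c ≡ toComp d → c ≡ d
  toComp-injective {m} {c} {d} e = trans (sym (cuts-toComp c)) (trans (cong (cuts m) e) (cuts-toComp d))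

  compositions-select : ∀ m (f : Vec Bool m → Bool) (Q : List ℕ → Set) →
    (∀ γ → IsComposition (suc m) γ → Q γ ⇔ f (cuts m γ) ≡ true) →
    Enumerates (λ γ → IsComposition (suc m) γ × Q γ) (map toComp (select f (allVec m)))
  compositions-select m f Q Q⇔f =
    Unique.map⁺ toComp-injective (Unique.filter⁺ (holds? f) (allVec-unique m)) , sound , complete
    where
      sound : ∀ γ → γ ∈ map toComp (select f (allVec m)) → IsComposition (suc m) γ × Q γ
      sound γ γ∈ with ∈-map⁻ toComp γ∈
      ... | c , c∈ , refl = icγ , Equivalence.from (Q⇔f (toComp c) icγ)
                                    (subst (λ v → f v ≡ true) (sym (cuts-toComp c))
                                           (proj₂ (∈-filter⁻ (holds? f) {xs = allVec m} c∈)))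
        where icγ = toComp-composition c
      complete : ∀ γ → IsComposition (suc m) γ × Q γ → γ ∈ map toComp (select f (allVec m))
      complete γ (icγ , Qγ) = subst (_∈ map toComp (select f (allVec m))) (toComp-cuts icγ)
        (∈-map⁺ toComp (∈-filter⁺ (holds? f) (allVec-complete (cuts m γ)) (Equivalence.to (Q⇔f γ icγ) Qγ)))

  length-toComp : ∀ {m} (v : Vec Bool m) → length (toComp v) ≡ suc ∣ v ∣
  length-toComp = length-runs 1
    where
      length-runs : ∀ {m} acc (v : Vec Bool m) → length (runs acc v) ≡ suc ∣ v ∣
      length-runs acc []          = refl
      length-runs acc (true ∷ v)  = cong suc (length-runs 1 v)
      length-runs acc (false ∷ v) = length-runs (suc acc) v

  sumℤ-compositions : ∀ m L → Enumerates (IsComposition (suc m)) L → ∀ (w : List ℕ → ℤ) →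
    sumℤ (map w L) ≡ Σᶻ m (λ c → w (toComp c))
  sumℤ-compositions m L (uL , sound , complete) w =
    trans (sumℤ-enumeration w L (map toComp (allVec m)) uL (Unique.map⁺ toComp-injective (allVec-unique m)) to from)
          (trans (cong sumℤ (sym (map-∘ (allVec m)))) (sumℤ-allVec m (λ c → w (toComp c))))
    where
      to : ∀ γ → γ ∈ L → γ ∈ map toComp (allVec m)
      to γ γ∈L = subst (_∈ map toComp (allVec m)) (toComp-cuts (sound γ γ∈L)) (∈-map⁺ toComp (allVec-complete (cuts m γ)))
      from : ∀ γ → γ ∈ map toComp (allVec m) → γ ∈ L
      from γ γ∈ with ∈-map⁻ toComp γ∈
      ... | c , _ , refl = complete (toComp c) (toComp-composition c)

module ChainCoordinates where

  open SubsetsAsVectors using (false≢true)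
  open import Data.Nat
  open import Data.Nat.Properties
  open import Data.Bool using (Bool; true; false; if_then_else_)
  open import Data.Bool.Properties using (¬-not)
  open import Data.Fin using (Fin; toℕ; fromℕ<; zero; suc)
  open import Data.Fin.Properties using (toℕ-fromℕ<; toℕ-injective; toℕ<n)
  open import Data.List using (List; []; _∷_; length; lookup; map; allFin; cartesianProductWith)
  open import Data.List.Properties using (length-++; length-map; length-tabulate)
  open import Data.Nat.ListAction using (product)
  open import Data.List.Membership.Propositional using (_∈_)
  open import Data.List.Membership.Propositional.Properties using (∈-cartesianProductWith⁺; ∈-allFin)
  open import Data.List.Relation.Unary.Any using (here)
  open import Data.List.Relation.Unary.All using ([])
  open import Data.List.Relation.Unary.AllPairs using ([]; _∷_)
  open import Data.List.Relation.Unary.Unique.Propositional using (Unique)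
  import Data.List.Relation.Unary.Unique.Propositional.Properties as Unique
  open import Function using (id)
  open import Data.Product using (_×_; _,_; proj₂)
  open import Data.Unit using (⊤; tt)
  open import Data.Empty using (⊥-elim)
  open import Relation.Binary.PropositionalEquality

  data Tuple : List ℕ → Set where
    []  : Tuple []
    _∷_ : ∀ {c cs} → Fin c → Tuple cs → Tuple (c ∷ cs)

  component : ∀ {cs} → Tuple cs → (j : Fin (length cs)) → Fin (lookup cs j)
  component (x ∷ xs) zero    = x
  component (x ∷ xs) (suc j) = component xs j

  tuple : ∀ cs → ((j : Fin (length cs)) → Fin (lookup cs j)) → Tuple cs
  tuple []       y = []
  tuple (c ∷ cs) y = y zero ∷ tuple cs (λ j → y (suc j))

  component-tuple : ∀ cs y (j : Fin (length cs)) → component (tuple cs y) j ≡ y j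
  component-tuple (c ∷ cs) y zero    = refl
  component-tuple (c ∷ cs) y (suc j) = component-tuple cs (λ j → y (suc j)) j

  _≤ᵗ_ : ∀ {cs} → Tuple cs → Tuple cs → Set
  []       ≤ᵗ []       = ⊤
  (x ∷ xs) ≤ᵗ (y ∷ ys) = toℕ x ≤ toℕ y × xs ≤ᵗ ys

  ≤ᵗ⇒pointwise : ∀ {cs} (x y : Tuple cs) → x ≤ᵗ y → ∀ j → toℕ (component x j) ≤ toℕ (component y j)
  ≤ᵗ⇒pointwise (x ∷ xs) (y ∷ ys) (x≤y , _)    zero    = x≤y
  ≤ᵗ⇒pointwise (x ∷ xs) (y ∷ ys) (_ , xs≤ys) (suc j) = ≤ᵗ⇒pointwise xs ys xs≤ys j

  pointwise⇒≤ᵗ : ∀ {cs} (x y : Tuple cs) → (∀ j → toℕ (component x j) ≤ toℕ (component y j)) → x ≤ᵗ y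
  pointwise⇒≤ᵗ []       []       _ = tt
  pointwise⇒≤ᵗ (x ∷ xs) (y ∷ ys) h = h zero , pointwise⇒≤ᵗ xs ys (λ j → h (suc j))

  toBit : Bool → Fin 2
  toBit false = zero
  toBit true  = suc zero

  fromBit : Fin 2 → Bool
  fromBit zero       = false
  fromBit (suc zero) = true

  fromBit-toBit : ∀ b → fromBit (toBit b) ≡ b
  fromBit-toBit false = refl
  fromBit-toBit true  = refl

  toBit-fromBit : ∀ x → toBit (fromBit x) ≡ x
  toBit-fromBit zero       = refl
  toBit-fromBit (suc zero) = refl

  toBit-mono : ∀ {a b} → (a ≡ true → b ≡ true) → toℕ (toBit a) ≤ toℕ (toBit b)
  toBit-mono {false} _   = z≤n
  toBit-mono {true}  a⇒b rewrite a⇒b refl = ≤-refl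

  fromBit-mono : ∀ (x y : Fin 2) → toℕ x ≤ toℕ y → fromBit x ≡ true → fromBit y ≡ true
  fromBit-mono (suc zero) (suc zero) _ _ = refl

  initial : ℕ → ℕ → Bool
  initial i       zero          = false
  initial zero    (suc k)       = false
  initial (suc i) (suc zero)    = true
  initial (suc i) (suc (suc k)) = initial i (suc k)

  initial-bounds : ∀ i k → initial i k ≡ true → 1 ≤ k × k ≤ i
  initial-bounds (suc i) (suc zero)    _ = s≤s z≤n , s≤s z≤n
  initial-bounds (suc i) (suc (suc k)) e with initial-bounds i (suc k) e
  ... | _ , k≤i = s≤s z≤n , s≤s k≤i

  initial-intro : ∀ i k → 1 ≤ k → k ≤ i → initial i k ≡ true
  initial-intro (suc i) (suc zero)    _ _         = refl
  initial-intro (suc i) (suc (suc k)) _ (s≤s k≤i) = initial-intro i (suc k) (s≤s z≤n) k≤i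

  initial-beyond : ∀ i k → i < k → initial i k ≡ false
  initial-beyond i k i<k = ¬-not λ e → <⇒≱ i<k (proj₂ (initial-bounds i k e))

  initial-mono : ∀ {i j} → i ≤ j → ∀ k → initial i k ≡ true → initial j k ≡ true
  initial-mono {i} {j} i≤j k e with initial-bounds i k e
  ... | 1≤k , k≤i = initial-intro j k 1≤k (≤-trans k≤i i≤j)

  IsInitial : ℕ → (ℕ → Bool) → Set
  IsInitial j f = ∀ k → 1 ≤ k → suc k ≤ j → f (suc k) ≡ true → f k ≡ true

  isInitial-cong : ∀ j {f g} → (∀ k → 1 ≤ k → k ≤ j → f k ≡ g k) → IsInitial j f → IsInitial j g
  isInitial-cong j f≡g init k 1≤k k<j e =
    trans (sym (f≡g k 1≤k (≤-trans (n≤1+n k) k<j))) (init k 1≤k k<j (trans (f≡g (suc k) (s≤s z≤n) k<j) e))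

  initial-isInitial : ∀ j i → IsInitial j (initial i)
  initial-isInitial j i k 1≤k _ e with initial-bounds i (suc k) e
  ... | _ , sk≤i = initial-intro i k 1≤k (≤-trans (n≤1+n k) sk≤i)

  run : ℕ → (ℕ → Bool) → ℕ
  run zero    f = 0
  run (suc j) f = if f 1 then suc (run j (λ k → f (suc k))) else 0

  run≤ : ∀ j f → run j f ≤ j
  run≤ zero    f = z≤n
  run≤ (suc j) f with f 1
  ... | true  = s≤s (run≤ j _)
  ... | false = z≤n

  run-cong : ∀ j {f g} → (∀ k → 1 ≤ k → k ≤ j → f k ≡ g k) → run j f ≡ run j g
  run-cong zero    f≡g = refl
  run-cong (suc j) {g = g} f≡g rewrite f≡g 1 (s≤s z≤n) (s≤s z≤n) with g 1
  ... | true  = cong suc (run-cong j λ k _ k≤j → f≡g (suc k) (s≤s z≤n) (s≤s k≤j))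
  ... | false = refl

  run-mono : ∀ j f g → (∀ k → f k ≡ true → g k ≡ true) → run j f ≤ run j g
  run-mono zero    f g f⊆g = z≤n
  run-mono (suc j) f g f⊆g with f 1 in e₁ | g 1 in e₂
  ... | false | _     = z≤n
  ... | true  | true  = s≤s (run-mono j _ _ λ k → f⊆g (suc k))
  ... | true  | false = ⊥-elim (false≢true (trans (sym e₂) (f⊆g 1 e₁)))

  run-initial : ∀ j i → i ≤ j → run j (initial i) ≡ i
  run-initial zero    zero    _         = refl
  run-initial (suc j) zero    _         = refl
  run-initial (suc j) (suc i) (s≤s i≤j) =
    cong suc (trans (run-cong j λ { (suc k) _ _ → refl }) (run-initial j i i≤j))

  isInitial-run : ∀ j f → IsInitial j f → ∀ k → 1 ≤ k → k ≤ j → f k ≡ initial (run j f) k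
  isInitial-run zero    f _    k 1≤k k≤0 = ⊥-elim (<-irrefl refl (≤-trans 1≤k k≤0))
  isInitial-run (suc j) f init k 1≤k k≤j with f 1 in e
  isInitial-run (suc j) f init (suc zero)    _ _           | true  = e
  isInitial-run (suc j) f init (suc (suc k)) _ (s≤s k≤j)   | true  =
    isInitial-run j (λ k → f (suc k)) (λ k _ sk≤j → init (suc k) (s≤s z≤n) (s≤s sk≤j)) (suc k) (s≤s z≤n) k≤j
  isInitial-run (suc j) f init k 1≤k k≤j | false = trans (empty k 1≤k k≤j) (sym (initial-beyond 0 k 1≤k))
    where
      empty : ∀ k → 1 ≤ k → k ≤ suc j → f k ≡ false
      empty (suc zero)    _ _    = e
      empty (suc (suc k)) _ k<sj = ¬-not λ fk → false≢true (trans (sym (empty (suc k) (s≤s z≤n) (≤-trans (n≤1+n _) k<sj)))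
                                                                 (init (suc k) (s≤s z≤n) k<sj fk))

  runFin : ∀ j → (ℕ → Bool) → Fin (suc j)
  runFin j f = fromℕ< (s≤s (run≤ j f))

  toℕ-runFin : ∀ j f → toℕ (runFin j f) ≡ run j f
  toℕ-runFin j f = toℕ-fromℕ< (s≤s (run≤ j f))

  runFin-cong : ∀ j {f g} → (∀ k → 1 ≤ k → k ≤ j → f k ≡ g k) → runFin j f ≡ runFin j g
  runFin-cong j f≡g = toℕ-injective (trans (toℕ-runFin j _) (trans (run-cong j f≡g) (sym (toℕ-runFin j _))))

  runFin-mono : ∀ j f g → (∀ k → f k ≡ true → g k ≡ true) → toℕ (runFin j f) ≤ toℕ (runFin j g)
  runFin-mono j f g f⊆g = subst₂ _≤_ (sym (toℕ-runFin j f)) (sym (toℕ-runFin j g)) (run-mono j f g f⊆g)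

  runFin-initial : ∀ j (i : Fin (suc j)) → runFin j (initial (toℕ i)) ≡ i
  runFin-initial j i = toℕ-injective (trans (toℕ-runFin j _) (run-initial j (toℕ i) (≤-pred (toℕ<n i))))

  prepend : ∀ {c cs} → Fin c → Tuple cs → Tuple (c ∷ cs)
  prepend = _∷_

  allTuples : ∀ cs → List (Tuple cs)
  allTuples []       = [] ∷ []
  allTuples (c ∷ cs) = cartesianProductWith prepend (allFin c) (allTuples cs)

  allTuples-complete : ∀ {cs} (y : Tuple cs) → y ∈ allTuples cs
  allTuples-complete []       = here refl
  allTuples-complete (x ∷ y) = ∈-cartesianProductWith⁺ prepend (∈-allFin x) (allTuples-complete y)

  allTuples-unique : ∀ cs → Unique (allTuples cs)
  allTuples-unique []       = [] ∷ []
  allTuples-unique (c ∷ cs) = Unique.cartesianProductWith⁺ prepend ∷-injective (Unique.allFin⁺ c) (allTuples-unique cs)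
    where ∷-injective : ∀ {x x' : Fin c} {y y' : Tuple cs} → x ∷ y ≡ x' ∷ y' → x ≡ x' × y ≡ y'
          ∷-injective refl = refl , refl

  length-allTuples : ∀ cs → length (allTuples cs) ≡ product cs
  length-allTuples []       = refl
  length-allTuples (c ∷ cs) =
    trans (length-product (allFin c) (allTuples cs)) (cong₂ _*_ (length-tabulate {n = c} id) (length-allTuples cs))
    where
      length-product : ∀ (xs : List (Fin c)) (ys : List (Tuple cs)) →
                       length (cartesianProductWith prepend xs ys) ≡ length xs * length ys
      length-product []       ys = refl
      length-product (x ∷ xs) ys = trans (length-++ (map (prepend x) ys)) (cong₂ _+_ (length-map (prepend x) ys) (length-product xs ys))

module ChainDecomposition where

  open import Defs
  open SubsetsAsVectors
  open Blocks
  open Cuts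
  open LocalForm
  open ChainCoordinates
  open import Data.Nat
  open import Data.Nat.Properties
  open import Data.Bool using (Bool; true; false; if_then_else_)
  open import Data.Fin using (Fin; toℕ)
  open import Data.Fin.Properties using (toℕ<n)
  open import Data.List using (List; []; _∷_; length; lookup; map)
  open import Data.List.Properties using (length-map)
  open import Data.List.Membership.Propositional.Properties using (∈-map⁺; ∈-map⁻)
  import Data.List.Relation.Unary.Unique.Propositional.Properties as Unique
  open import Function using (_∘_)
  open import Data.Nat.Tactic.RingSolver using (solve-∀)
  open import Data.Nat.ListAction using (sum; product)
  open import Data.List.Relation.Unary.All using ([]; _∷_)
  open import Data.Product using (Σ; ∃; _×_; _,_; proj₁; proj₂)
  open import Data.Fin.Subset using (Subset; _⊆_)
  open import Function.Bundles using (_⇔_; mk⇔; Equivalence)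
  open import Data.Sum using (inj₁; inj₂)
  open import Data.Unit using (⊤; tt)
  open import Data.Empty using (⊥-elim)
  open import Relation.Nullary using (yes; no)
  open import Relation.Binary.PropositionalEquality
  open import Relation.Binary.Definitions using (Tri; tri<; tri≈; tri>)

  glue : ℕ → (ℕ → Bool) → Bool → (ℕ → Bool) → ℕ → Bool
  glue a h β g k = if k <ᵇ a then h k else (if k ≡ᵇ a then β else g (k ∸ a))

  glue-below : ∀ a h β g k → k < a → glue a h β g k ≡ h k
  glue-below (suc a) h β g zero    _         = refl
  glue-below (suc a) h β g (suc k) (s≤s k<a) = glue-below a (λ k → h (suc k)) β g k k<a

  glue-at : ∀ a h β g → glue a h β g a ≡ β
  glue-at zero    h β g = refl
  glue-at (suc a) h β g = glue-at a (λ k → h (suc k)) β g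

  glue-above : ∀ a h β g k → 1 ≤ k → glue a h β g (a + k) ≡ g k
  glue-above zero    h β g (suc k) _   = refl
  glue-above (suc a) h β g k       1≤k = glue-above a (λ k → h (suc k)) β g k 1≤k

  -- The chain sizes of U_α: αᵢ for the initial segment inside block i, and 2
  -- for the membership of each cut.
  chainSizes : List ℕ → List ℕ
  chainSizes []           = []
  chainSizes (a ∷ [])     = suc (pred a) ∷ []
  chainSizes (a ∷ b ∷ as) = suc (pred a) ∷ 2 ∷ chainSizes (b ∷ as)

  encode : (α : List ℕ) → (ℕ → Bool) → Tuple (chainSizes α)
  encode []           f = []
  encode (a ∷ [])     f = runFin (pred a) f ∷ []
  encode (a ∷ b ∷ as) f = runFin (pred a) f ∷ toBit (f a) ∷ encode (b ∷ as) (λ k → f (a + k))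

  decode : (α : List ℕ) → Tuple (chainSizes α) → ℕ → Bool
  decode []           []              k = false
  decode (a ∷ [])     (i ∷ [])          = initial (toℕ i)
  decode (a ∷ b ∷ as) (i ∷ x ∷ y)       = glue a (initial (toℕ i)) (fromBit x) (decode (b ∷ as) y)

  BlockwiseInitial : List ℕ → (ℕ → Bool) → Set
  BlockwiseInitial []           f = ⊤
  BlockwiseInitial (a ∷ [])     f = IsInitial (pred a) f
  BlockwiseInitial (a ∷ b ∷ as) f = IsInitial (pred a) f × BlockwiseInitial (b ∷ as) (λ k → f (a + k))

  sum-positive : ∀ {a as} → PositiveParts (a ∷ as) → 1 ≤ sum (a ∷ as)
  sum-positive {a} {as} (1≤a ∷ _) = ≤-trans 1≤a (m≤m+n a (sum as))

  private
    1≤a+k : ∀ a {k} → 1 ≤ k → 1 ≤ a + k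
    1≤a+k a {k} 1≤k = ≤-trans 1≤k (m≤n+m k a)

  blockwise-cong : ∀ α {f g} → (∀ k → 1 ≤ k → f k ≡ g k) → BlockwiseInitial α f → BlockwiseInitial α g
  blockwise-cong []           f≡g _              = tt
  blockwise-cong (a ∷ [])     f≡g init           = isInitial-cong (pred a) (λ k 1≤k _ → f≡g k 1≤k) init
  blockwise-cong (a ∷ b ∷ as) f≡g (init , rest) =
    isInitial-cong (pred a) (λ k 1≤k _ → f≡g k 1≤k) init ,
    blockwise-cong (b ∷ as) (λ k 1≤k → f≡g (a + k) (1≤a+k a 1≤k)) rest

  encode-cong : ∀ {α} → PositiveParts α → ∀ {f g} → (∀ k → 1 ≤ k → f k ≡ g k) → encode α f ≡ encode α g
  encode-cong {[]}         _           f≡g = refl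
  encode-cong {a ∷ []}     _           f≡g = cong (_∷ []) (runFin-cong (pred a) λ k 1≤k _ → f≡g k 1≤k)
  encode-cong {a ∷ b ∷ as} (1≤a ∷ pos) f≡g =
    cong₂ _∷_ (runFin-cong (pred a) λ k 1≤k _ → f≡g k 1≤k)
              (cong₂ _∷_ (cong toBit (f≡g a 1≤a)) (encode-cong pos λ k 1≤k → f≡g (a + k) (1≤a+k a 1≤k)))

  encode-decode : ∀ {α} → PositiveParts α → ∀ y → encode α (decode α y) ≡ y
  encode-decode {[]}               _           []       = refl
  encode-decode {suc a ∷ []}       _           (i ∷ []) = cong (_∷ []) (runFin-initial a i)
  encode-decode {suc a ∷ b ∷ as} (_ ∷ pos) (i ∷ x ∷ y) =
    cong₂ _∷_ (trans (runFin-cong a λ k _ k≤a → glue-below (suc a) h β g k (s≤s k≤a))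
                     (runFin-initial a i))
      (cong₂ _∷_ (trans (cong toBit (glue-at (suc a) h β g)) (toBit-fromBit x))
                 (trans (encode-cong pos λ k 1≤k → glue-above (suc a) h β g k 1≤k) (encode-decode pos y)))
    where
      h = initial (toℕ i)
      β = fromBit x
      g = decode (b ∷ as) y
  encode-decode {zero ∷ _} (() ∷ _) _

  decode-mono : ∀ α (y y' : Tuple (chainSizes α)) → y ≤ᵗ y' → ∀ k → decode α y k ≡ true → decode α y' k ≡ true
  decode-mono []           []          []            _ _ ()
  decode-mono (a ∷ [])     (i ∷ [])    (i' ∷ [])     (i≤i' , _)          k e = initial-mono i≤i' k e
  decode-mono (a ∷ b ∷ as) (i ∷ x ∷ y) (i' ∷ x' ∷ y') (i≤i' , x≤x' , y≤y') k e with k <ᵇ a | k ≡ᵇ a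
  ... | true  | _     = initial-mono i≤i' k e
  ... | false | true  = fromBit-mono x x' x≤x' e
  ... | false | false = decode-mono (b ∷ as) y y' y≤y' (k ∸ a) e

  encode-mono : ∀ α f g → (∀ k → f k ≡ true → g k ≡ true) → encode α f ≤ᵗ encode α g
  encode-mono []           f g f⊆g = tt
  encode-mono (a ∷ [])     f g f⊆g = runFin-mono (pred a) f g f⊆g , tt
  encode-mono (a ∷ b ∷ as) f g f⊆g =
    runFin-mono (pred a) f g f⊆g , toBit-mono (f⊆g a) , encode-mono (b ∷ as) _ _ (λ k → f⊆g (a + k))

  decode-valid : ∀ {α} → PositiveParts α → ∀ y →
    BlockwiseInitial α (decode α y) × (∀ k → sum α ≤ k → decode α y k ≡ false)
  decode-valid {[]} _ [] = tt , λ _ _ → refl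
  decode-valid {suc a ∷ []} _ (i ∷ []) =
    initial-isInitial a (toℕ i) ,
    λ k sa≤k → initial-beyond (toℕ i) k (<-≤-trans (toℕ<n i) (≤-trans (≤-reflexive (sym (+-identityʳ (suc a)))) sa≤k))
  decode-valid {suc a ∷ b ∷ as} (_ ∷ pos) (i ∷ x ∷ y) with decode-valid pos y
  ... | valid , vanish =
    (isInitial-cong a (λ k _ k≤a → sym (glue-below (suc a) h β g k (s≤s k≤a))) (initial-isInitial a (toℕ i)) ,
     blockwise-cong (b ∷ as) (λ k 1≤k → sym (glue-above (suc a) h β g k 1≤k)) valid) ,
    beyond
    where
      h = initial (toℕ i)
      β = fromBit x
      g = decode (b ∷ as) y
      beyond : ∀ k → suc a + sum (b ∷ as) ≤ k → glue (suc a) h β g k ≡ false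
      beyond k n≤k = subst (λ z → glue (suc a) h β g z ≡ false) (m+[n∸m]≡n sa≤k)
                       (trans (glue-above (suc a) h β g (k ∸ suc a) 1≤k') (vanish (k ∸ suc a) sum≤k'))
        where
          sa≤k : suc a ≤ k
          sa≤k = ≤-trans (m≤m+n (suc a) _) n≤k
          sum≤k' : sum (b ∷ as) ≤ k ∸ suc a
          sum≤k' = subst (_≤ k ∸ suc a) (m+n∸m≡n (suc a) _) (∸-monoˡ-≤ (suc a) n≤k)
          1≤k' : 1 ≤ k ∸ suc a
          1≤k' = ≤-trans (sum-positive pos) sum≤k'
  decode-valid {zero ∷ _} (() ∷ _) _

  decode-encode : ∀ {α} → PositiveParts α → ∀ f → BlockwiseInitial α f → (∀ k → sum α ≤ k → f k ≡ false) →
    ∀ k → 1 ≤ k → decode α (encode α f) k ≡ f k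
  decode-encode {[]} _ f _ vanish k _ = sym (vanish k z≤n)
  decode-encode {suc a ∷ []} _ f init vanish k 1≤k with k ≤? a
  ... | yes k≤a = sym (trans (isInitial-run a f init k 1≤k k≤a) (cong (λ r → initial r k) (sym (toℕ-runFin a f))))
  ... | no  k≰a = trans (initial-beyond _ k (subst (_< k) (sym (toℕ-runFin a f)) (<-≤-trans (s≤s (run≤ a f)) (≰⇒> k≰a))))
                        (sym (vanish k (subst (_≤ k) (sym (+-identityʳ (suc a))) (≰⇒> k≰a))))
  decode-encode {suc a ∷ b ∷ as} (_ ∷ pos) f (init , rest) vanish k 1≤k = by-position (<-cmp k (suc a))
    where
      h = initial (toℕ (runFin a f))
      β = fromBit (toBit (f (suc a)))
      g = decode (b ∷ as) (encode (b ∷ as) (λ k → f (suc a + k)))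
      by-position : Tri (k < suc a) (k ≡ suc a) (suc a < k) → glue (suc a) h β g k ≡ f k
      by-position (tri< k<sa _ _) =
        trans (glue-below (suc a) h β g k k<sa)
              (trans (cong (λ r → initial r k) (toℕ-runFin a f)) (sym (isInitial-run a f init k 1≤k (≤-pred k<sa))))
      by-position (tri≈ _ k≡sa _) rewrite k≡sa = trans (glue-at (suc a) h β g) (fromBit-toBit (f (suc a)))
      by-position (tri> _ _ sa<k) =
        subst (λ z → glue (suc a) h β g z ≡ f z) (m+[n∸m]≡n (<⇒≤ sa<k))
          (trans (glue-above (suc a) h β g (k ∸ suc a) (m<n⇒0<n∸m sa<k))
                 (decode-encode pos _ rest (λ k' sum≤k' → vanish (suc a + k') (+-monoʳ-≤ (suc a) sum≤k'))
                                (k ∸ suc a) (m<n⇒0<n∸m sa<k)))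
  decode-encode {zero ∷ _} (() ∷ _) _ _ _ _ _

  local⇒blockwise : ∀ {α} → PositiveParts α → ∀ f → LocalCondition (sum α) α (λ k → f k ≡ true) → BlockwiseInitial α f
  local⇒blockwise {[]}        _ f L = tt
  local⇒blockwise {suc a ∷ []} _ f L k 1≤k sk≤a fsk =
    L k 1≤k (≤-trans sk≤a (≤-trans (n≤1+n a) (≤-reflexive (sym (+-identityʳ (suc a))))))
      (no-cuts-singleton _ k) (no-cuts-singleton _ (suc k)) fsk
  local⇒blockwise {suc a ∷ b ∷ as} (_ ∷ pos@(1≤b ∷ _)) f L = first-block , local⇒blockwise pos _ L'
    where
      first-block : IsInitial a f
      first-block k 1≤k sk≤a fsk =
        L k 1≤k (≤-trans sk≤a (≤-trans (n≤1+n a) (m≤m+n (suc a) _)))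
          (before-first-cut 1≤b (≤-trans (s≤s (n≤1+n k)) (s≤s sk≤a))) (before-first-cut 1≤b (s≤s sk≤a)) fsk
      L' : LocalCondition (sum (b ∷ as)) (b ∷ as) (λ k → f (suc a + k) ≡ true)
      L' x 1≤x sx≤n x∉S sx∉S fsx =
        L (suc a + x) (1≤a+k (suc a) 1≤x) (subst (_≤ suc a + sum (b ∷ as)) (+-suc (suc a) x) (+-monoʳ-≤ (suc a) sx≤n))
          (λ p → x∉S (∈S-unshift 1≤b 1≤x p))
          (λ p → sx∉S (∈S-unshift 1≤b (s≤s z≤n) (subst (_∈S (suc a ∷ b ∷ as)) (sym (+-suc (suc a) x)) p)))
          (subst (λ z → f z ≡ true) (+-suc (suc a) x) fsx)

  blockwise⇒local : ∀ {α} → PositiveParts α → ∀ f → f (sum α) ≡ false → BlockwiseInitial α f →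
                    LocalCondition (sum α) α (λ k → f k ≡ true)
  blockwise⇒local {suc a ∷ []} _ f fn≡f init x 1≤x sx≤n _ _ fsx with suc x ≤? a
  ... | yes sx≤a = init x 1≤x sx≤a fsx
  ... | no  sx≰a = ⊥-elim (false≢true (trans (sym fn≡f) (trans (cong f n≡sx) fsx)))
    where n≡sx = ≤-antisym (subst (_≤ suc x) (sym (+-identityʳ (suc a))) (≰⇒> sx≰a)) sx≤n
  blockwise⇒local {suc a ∷ b ∷ as} (_ ∷ pos) f fn≡f (init , rest) x 1≤x sx≤n x∉S sx∉S fsx with <-cmp (suc x) (suc a)
  ... | tri< sx<sa _ _ = init x 1≤x (≤-pred sx<sa) fsx
  ... | tri≈ _ sx≡sa _ = ⊥-elim (sx∉S (subst (_∈S (suc a ∷ b ∷ as)) (sym sx≡sa) (head-∈S (suc a) b as)))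
  ... | tri> _ _ sa<sx with m≤n⇒m<n∨m≡n (≤-pred sa<sx)
  ...   | inj₂ sa≡x  = ⊥-elim (x∉S (subst (_∈S (suc a ∷ b ∷ as)) sa≡x (head-∈S (suc a) b as)))
  ...   | inj₁ sa<x  = subst (λ z → f z ≡ true) a+x'≡x
      (blockwise⇒local pos (λ k → f (suc a + k)) fn≡f rest x' 1≤x'
        (+-cancelˡ-≤ (suc a) _ _ (subst (_≤ suc a + sum (b ∷ as)) (trans (cong suc (sym a+x'≡x)) (sym (+-suc (suc a) x'))) sx≤n))
        (λ p → x∉S (subst (_∈S (suc a ∷ b ∷ as)) a+x'≡x (∈S-cons⁺ p)))
        (λ p → sx∉S (subst (_∈S (suc a ∷ b ∷ as)) (trans (+-suc (suc a) x') (cong suc a+x'≡x)) (∈S-cons⁺ p)))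
        (subst (λ z → f z ≡ true) (trans (cong suc (sym a+x'≡x)) (sym (+-suc (suc a) x'))) fsx))
    where
      x' = x ∸ suc a
      a+x'≡x : suc a + x' ≡ x
      a+x'≡x = m+[n∸m]≡n (<⇒≤ sa<x)
      1≤x' : 1 ≤ x'
      1≤x' = m<n⇒0<n∸m sa<x
  blockwise⇒local {zero ∷ _} (() ∷ _)

  has-beyond-last : ∀ n (S : Subset (n ∸ 1)) k → n ≤ k → has S k ≡ false
  has-beyond-last zero    S zero    _   = has-zero S
  has-beyond-last zero    S (suc k) _   = has-beyond S (suc k) (s≤s z≤n)
  has-beyond-last (suc m) S k       m<k = has-beyond S k m<k

  beyond-last : ∀ n k → 1 ≤ k → n ∸ 1 < k → n ≤ k
  beyond-last zero    k _ _   = z≤n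
  beyond-last (suc m) k _ m<k = m<k

  inU⇔blockwise : ∀ {n α} → IsComposition n α → (S : Subset (n ∸ 1)) → InU α S ⇔ BlockwiseInitial α (has S)
  inU⇔blockwise {α = α} (pos , refl) S = mk⇔
    (λ u → local⇒blockwise pos (has S) (unimodal⇒local (pos , refl) (unimodal-cong (∈ₙ⇒has S) (has⇒∈ₙ S) u)))
    (λ b → unimodal-cong (has⇒∈ₙ S) (∈ₙ⇒has S)
             (local⇒unimodal (pos , refl) (blockwise⇒local pos (has S) (has-beyond-last (sum α) S (sum α) ≤-refl) b)))

  fromCoordinates : ∀ n α → Tuple (chainSizes α) → Subset (n ∸ 1)
  fromCoordinates n α y = fromPred (n ∸ 1) (decode α y)

  has-fromCoordinates : ∀ {n α} → IsComposition n α → ∀ y k → 1 ≤ k → has (fromCoordinates n α y) k ≡ decode α y k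
  has-fromCoordinates {n} {α} (pos , sum≡) y k 1≤k with k ≤? n ∸ 1
  ... | yes k≤m = has-fromPred (n ∸ 1) (decode α y) k 1≤k k≤m
  ... | no  k≰m = trans (has-beyond (fromCoordinates n α y) k (≰⇒> k≰m))
                        (sym (proj₂ (decode-valid pos y) k (subst (_≤ k) (sym sum≡) (beyond-last n k 1≤k (≰⇒> k≰m)))))

  fromCoordinates-inU : ∀ {n α} → (ic : IsComposition n α) → ∀ y → InU α (fromCoordinates n α y)
  fromCoordinates-inU ic y = Equivalence.from (inU⇔blockwise ic _)
    (blockwise-cong _ (λ k 1≤k → sym (has-fromCoordinates ic y k 1≤k)) (proj₁ (decode-valid (proj₁ ic) y)))

  encode-fromCoordinates : ∀ {n α} → IsComposition n α → ∀ y → encode α (has (fromCoordinates n α y)) ≡ y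
  encode-fromCoordinates ic y = trans (encode-cong (proj₁ ic) (has-fromCoordinates ic y)) (encode-decode (proj₁ ic) y)

  fromCoordinates-encode : ∀ {n α} → IsComposition n α → ∀ S → InU α S → fromCoordinates n α (encode α (has S)) ≡ S
  fromCoordinates-encode {n} {α} ic@(pos , sum≡) S u = has-injective _ S agree
    where
      agree : ∀ k → has (fromCoordinates n α (encode α (has S))) k ≡ has S k
      agree zero    = trans (has-zero (fromCoordinates n α (encode α (has S)))) (sym (has-zero S))
      agree (suc k) = trans (has-fromCoordinates ic _ (suc k) (s≤s z≤n))
        (decode-encode pos (has S) (Equivalence.to (inU⇔blockwise ic S) u)
          (λ j sum≤j → has-beyond-last n S j (subst (_≤ j) sum≡ sum≤j)) (suc k) (s≤s z≤n))

  has-decode-encode : ∀ {n α} → IsComposition n α → ∀ S → InU α S →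
                      ∀ k → 1 ≤ k → has S k ≡ decode α (encode α (has S)) k
  has-decode-encode ic S u k 1≤k =
    trans (sym (cong (λ v → has v k) (fromCoordinates-encode ic S u))) (has-fromCoordinates ic _ k 1≤k)

  productOfChains : ∀ n α → IsComposition n α → ProductOfChains (InU {n ∸ 1} α) _⊆_
  productOfChains n α ic = length cs , lookup cs , φ , surjective , order
    where
      cs = chainSizes α
      φ : Σ (Subset (n ∸ 1)) (InU α) → (j : Fin (length cs)) → Fin (lookup cs j)
      φ (S , _) = component (encode α (has S))
      surjective : ∀ y → ∃ λ x → ∀ j → φ x j ≡ y j
      surjective y = (fromCoordinates n α (tuple cs y) , fromCoordinates-inU ic _) ,
                     λ j → trans (cong (λ z → component z j) (encode-fromCoordinates ic _)) (component-tuple cs y j)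
      order : ∀ x y → (proj₁ x ⊆ proj₁ y → ∀ j → toℕ (φ x j) ≤ toℕ (φ y j))
                    × ((∀ j → toℕ (φ x j) ≤ toℕ (φ y j)) → proj₁ x ⊆ proj₁ y)
      order (S , uS) (T , uT) =
        (λ S⊆T → ≤ᵗ⇒pointwise _ _ (encode-mono α _ _ (⊆⇒has S⊆T))) ,
        (λ φS≤φT → has⇒⊆ λ k Sk → included k Sk (pointwise⇒≤ᵗ _ _ φS≤φT))
        where
          included : ∀ k → has S k ≡ true → encode α (has S) ≤ᵗ encode α (has T) → has T k ≡ true
          included k Sk S≤T with has-true-bounds S k Sk
          ... | 1≤k , _ = trans (has-decode-encode ic T uT k 1≤k)
                            (decode-mono α _ _ S≤T k (trans (sym (has-decode-encode ic S uS k 1≤k)) Sk))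

  product-chainSizes : ∀ {α} → PositiveParts α → product (chainSizes α) ≡ 2 ^ (length α ∸ 1) * product α
  product-chainSizes {[]}             _         = refl
  product-chainSizes {suc a ∷ []}     _         = sym (+-identityʳ _)
  product-chainSizes {suc a ∷ b ∷ as} (_ ∷ pos) =
    trans (cong (λ z → suc a * (2 * z)) (product-chainSizes pos)) (regroup (suc a) (2 ^ length as) (product (b ∷ as)))
    where regroup : ∀ x y z → x * (2 * (y * z)) ≡ (2 * y) * (x * z)
          regroup = solve-∀
  product-chainSizes {zero ∷ _} (() ∷ _)

  partV : ∀ n α → IsComposition n α → PartV n α
  partV n α ic =
    map (fromCoordinates n α) (allTuples (chainSizes α)) ,
    (Unique.map⁺ injective (allTuples-unique _) , sound , complete) ,
    trans (length-map _ (allTuples (chainSizes α))) (trans (length-allTuples (chainSizes α)) (product-chainSizes (proj₁ ic)))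
    where
      injective : ∀ {y y'} → fromCoordinates n α y ≡ fromCoordinates n α y' → y ≡ y'
      injective {y} {y'} e = trans (sym (encode-fromCoordinates ic y)) (trans (cong (encode α ∘ has) e) (encode-fromCoordinates ic y'))
      sound : ∀ S → S ∈ˡ map (fromCoordinates n α) (allTuples (chainSizes α)) → InU α S
      sound S S∈ with ∈-map⁻ (fromCoordinates n α) S∈
      ... | y , _ , refl = fromCoordinates-inU ic y
      complete : ∀ S → InU α S → S ∈ˡ map (fromCoordinates n α) (allTuples (chainSizes α))
      complete S u = subst (_∈ˡ _) (fromCoordinates-encode ic S u) (∈-map⁺ (fromCoordinates n α) (allTuples-complete _))

module MobiusFunction where

  open import Defs
  open SubsetsAsVectors
  open Blocks
  open Cuts
  open TransferForm
  open Enumeration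
  open ChainDecomposition using (productOfChains)
  open import Data.Nat using (ℕ; zero; suc; pred; _∸_; _≤_; _<_; _≡ᵇ_; z≤n; s≤s)
  open import Data.Nat.Properties using (≤-refl; ≤-trans; ≤-pred; ≤∧≢⇒<; <-irrefl)
  open import Data.Integer using (ℤ; +_; -_; _+_; _*_; _^_)
  open import Data.Integer.Properties using (+-identityˡ)
  import Data.Nat.Properties
  open import Data.Bool using (Bool; true; false; _∧_; _∨_; if_then_else_)
  open import Data.Bool.Properties using (∨-conicalˡ; ∨-conicalʳ; ∧-conicalˡ; ∧-conicalʳ; ∨-zeroʳ; ¬-not)
  open import Data.Vec using ([]; _∷_)
  open import Data.Vec.Properties using (≡-dec)
  import Data.Bool as Bool
  open import Data.Fin.Subset using (Subset; _⊆_; _∩_; ∣_∣; ⊥)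
  open import Data.Fin.Subset.Properties
    using (_⊆?_; p⊆q⇒∣p∣≤∣q∣; drop-∷-⊆; p∩q⊆p; p∩q⊆q; x∈p∩q⁺; ⊥⊆; ∣⊥∣≡0)
  open import Data.List using (List; []; _∷_; map; filter)
  open import Data.List.Membership.Propositional.Properties using (∈-filter⁺; ∈-filter⁻)
  import Data.List.Relation.Unary.Unique.Propositional.Properties as Unique
  open import Data.Product using (Σ; ∃; _×_; _,_; proj₁; proj₂)
  open import Data.Sum using (_⊎_; inj₁; inj₂)
  open import Data.Empty using (⊥-elim) renaming (⊥ to Empty)
  open import Function using (_∘_; id)
  open import Function.Bundles using (_⇔_; mk⇔; Equivalence)
  open import Relation.Nullary using (¬_; Dec; yes; no; does)
  open import Relation.Nullary.Decidable using (dec-true; dec-false)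
  open import Relation.Binary.PropositionalEquality
  open import Data.Integer.Tactic.RingSolver using (solve-∀)

  special : List ℕ → ℕ → Bool
  special α k = isCut α k ∨ ((k ≡ᵇ 1) ∨ isCut α (pred k))

  specialSet : ∀ m → List ℕ → Subset m
  specialSet m α = fromPred m (special α)

  inSpecial⇔⊆ : ∀ {m α} → IsComposition (suc m) α → (S : Subset m) → InSpecial α S ⇔ S ⊆ specialSet m α
  inSpecial⇔⊆ {m} {α} (pos , _) S = mk⇔ to from
    where
      to : InSpecial α S → S ⊆ specialSet m α
      to inS = has⇒⊆ λ k Sk → let (1≤k , k≤m) = has-true-bounds S k Sk in
        trans (has-fromPred m (special α) k 1≤k k≤m) (is-special k (inS k (has⇒∈ₙ S k Sk)))
        where
          is-special : ∀ k → k ∈S α ⊎ ∃ (λ j → k ≡ suc j × (j ≡ 0 ⊎ j ∈S α)) → special α k ≡ true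
          is-special k (inj₁ k∈S) rewrite ∈S⇒isCut pos k∈S = refl
          is-special k (inj₂ (j , refl , inj₁ refl)) with isCut α 1
          ... | true  = refl
          ... | false = refl
          is-special k (inj₂ (j , refl , inj₂ j∈S)) rewrite ∈S⇒isCut pos j∈S with isCut α (suc j) | suc j ≡ᵇ 1
          ... | true  | _     = refl
          ... | false | true  = refl
          ... | false | false = refl
      from : S ⊆ specialSet m α → InSpecial α S
      from S⊆ k k∈S with ∈ₙ-bounds k∈S
      ... | 1≤k , k≤m =
        cases k 1≤k (trans (sym (has-fromPred m (special α) k 1≤k k≤m)) (⊆⇒has S⊆ k (∈ₙ⇒has S k k∈S)))
        where
          cases : ∀ k → 1 ≤ k → special α k ≡ true → k ∈S α ⊎ ∃ (λ j → k ≡ suc j × (j ≡ 0 ⊎ j ∈S α))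
          cases (suc j) _ e with isCut α (suc j) in c₁ | suc j ≡ᵇ 1 in c₂ | isCut α j in c₃
          ... | true  | _     | _    = inj₁ (isCut⇒∈S pos c₁)
          ... | false | true  | _    = inj₂ (j , refl , inj₁ (Data.Nat.Properties.suc-injective
                                                               (Data.Nat.Properties.≡ᵇ⇒≡ (suc j) 1 (subst Bool.T (sym c₂) _))))
          ... | false | false | true = inj₂ (j , refl , inj₂ (isCut⇒∈S pos c₃))

  -- Every subset of the special set is α-unimodal: a point x+1 of it with x ≥ 1
  -- is a cut or follows a cut.
  special-admissible : ∀ {m α} → IsComposition (suc m) α → ∀ T → T ⊆ specialSet m α →
                       admissible false (cuts m α) T ≡ true
  special-admissible {m} {α} ic T T⊆ = Equivalence.from (admissible⇔local (cuts m α) T) local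
    where
      local : LocalBool m (has (cuts m α)) (has T)
      local (suc x) _ sx<m cx csx Tsx = ⊥-elim (false≢true (trans (sym not-special) is-special))
        where
          is-special : special α (suc (suc x)) ≡ true
          is-special = trans (sym (has-fromPred m (special α) (suc (suc x)) (s≤s z≤n) sx<m)) (⊆⇒has T⊆ (suc (suc x)) Tsx)
          not-special : special α (suc (suc x)) ≡ false
          not-special rewrite sym (has-cuts ic (suc x)) | sym (has-cuts ic (suc (suc x))) | cx | csx = refl

  -- A nonempty α-unimodal set meets the special set: otherwise its least
  -- element k would have k-1 in the set as well.
  meets-special : ∀ {m α} → IsComposition (suc m) α → ∀ S → admissible false (cuts m α) S ≡ true →
    (∀ k → has S k ≡ true → has (specialSet m α) k ≡ true → Empty) → ∀ k → has S k ≡ false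
  meets-special {m} {α} ic S adm disjoint zero = has-zero S
  meets-special {m} {α} ic S adm disjoint (suc zero) = ¬-not λ S₁ →
    disjoint 1 S₁ (trans (has-fromPred m (special α) 1 ≤-refl (proj₂ (has-true-bounds S 1 S₁))) (∨-zeroʳ (isCut α 1)))
  meets-special {m} {α} ic S adm disjoint (suc (suc k)) =
    ¬-not λ Sk₂ → false≢true (trans (sym (meets-special ic S adm disjoint (suc k))) (step Sk₂))
    where
      step : has S (suc (suc k)) ≡ true → has S (suc k) ≡ true
      step Sk₂ with has-true-bounds S (suc (suc k)) Sk₂ | special α (suc (suc k)) in sp
      ... | _ , k₂≤m | true  = ⊥-elim (disjoint (suc (suc k)) Sk₂ (trans (has-fromPred m (special α) _ (s≤s z≤n) k₂≤m) sp))
      ... | _ , k₂≤m | false =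
        Equivalence.to (admissible⇔local (cuts m α) S) adm (suc k) (s≤s z≤n) k₂≤m
          (trans (has-cuts ic (suc k)) (∨-conicalʳ _ _ (∨-conicalʳ (isCut α (suc (suc k))) _ sp)))
          (trans (has-cuts ic (suc (suc k))) (∨-conicalˡ _ _ sp)) Sk₂

  private
    does-true : ∀ {A : Set} (a? : Dec A) → does a? ≡ true → A
    does-true (yes a) _ = a

    does-cong : ∀ {A B : Set} (a? : Dec A) (b? : Dec B) → (A → B) → (B → A) → does a? ≡ does b?
    does-cong (yes a) b? a⇒b b⇒a = sym (dec-true b? (a⇒b a))
    does-cong (no ¬a) b? a⇒b b⇒a = sym (dec-false b? (¬a ∘ b⇒a))

    ∧-intro : ∀ {a b} → a ≡ true → b ≡ true → a ∧ b ≡ true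
    ∧-intro refl refl = refl

    ⊆-∩ : ∀ {m} {T S P : Subset m} → T ⊆ S → T ⊆ P → T ⊆ S ∩ P
    ⊆-∩ T⊆S T⊆P x∈T = x∈p∩q⁺ (T⊆S x∈T , T⊆P x∈T)

    ⊆-size : ∀ {m} {T S : Subset m} → T ⊆ S → ∣ T ∣ ≡ ∣ S ∣ → T ≡ S
    ⊆-size {T = []}        {[]}        _    _ = refl
    ⊆-size {T = true ∷ T}  {true ∷ S}  T⊆S e = cong (true ∷_) (⊆-size (drop-∷-⊆ T⊆S) (Data.Nat.Properties.suc-injective e))
    ⊆-size {T = false ∷ T} {false ∷ S} T⊆S e = cong (false ∷_) (⊆-size (drop-∷-⊆ T⊆S) e)
    ⊆-size {T = true ∷ T}  {false ∷ S} T⊆S e with T⊆S Data.Vec.here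
    ... | ()
    ⊆-size {T = false ∷ T} {true ∷ S}  T⊆S e = ⊥-elim (<-irrefl e (s≤s (p⊆q⇒∣p∣≤∣q∣ (drop-∷-⊆ T⊆S))))

  mobiusFormula : ∀ m → List ℕ → Subset m → ℤ
  mobiusFormula m α T = if does (T ⊆? specialSet m α) then (- (+ 1)) ^ ∣ T ∣ else + 0

  alternating-sum : ∀ {m} (R : Subset m) → (Σ ℕ λ k → has R k ≡ true) →
    Σᶻ m (λ T → if does (T ⊆? R) then (- (+ 1)) ^ ∣ T ∣ else + 0) ≡ + 0
  alternating-sum {suc m} (true ∷ R) _ =
    trans (cong (_+ Σᶻ m h) (trans (Σᶻ-cong m negate) (Σᶻ-* m (- (+ 1)) h))) (cancel (Σᶻ m h))
    where
      h : Subset m → ℤ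
      h T = if does (T ⊆? R) then (- (+ 1)) ^ ∣ T ∣ else + 0
      negate : ∀ T → (if does (T ⊆? R) then (- (+ 1)) * (- (+ 1)) ^ ∣ T ∣ else + 0) ≡ - (+ 1) * h T
      negate T with does (T ⊆? R)
      ... | true  = refl
      ... | false = refl
      cancel : ∀ x → - (+ 1) * x + x ≡ + 0
      cancel = solve-∀
  alternating-sum {suc m} (false ∷ R) (suc (suc k) , e) =
    trans (cong (_+ Σᶻ m h) (Σᶻ-zero m)) (trans (+-identityˡ (Σᶻ m h)) (alternating-sum R (suc k , e)))
    where
      h : Subset m → ℤ
      h T = if does (T ⊆? R) then (- (+ 1)) ^ ∣ T ∣ else + 0
  alternating-sum {suc m} (false ∷ R) (zero , ())
  alternating-sum {suc m} (false ∷ R) (suc zero , ())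

  unimodal-meets-special : ∀ {m α} → IsComposition (suc m) α → ∀ S → InU α S → S ≢ ⊥ →
    Σ ℕ λ k → has (S ∩ specialSet m α) k ≡ true
  unimodal-meets-special {m} {α} ic S uS S≢⊥ with has-witness (S ∩ specialSet m α)
  ... | inj₁ w    = w
  ... | inj₂ none = ⊥-elim (S≢⊥ (has-injective S ⊥ λ k → trans
        (meets-special ic S (Equivalence.to (inU⇔admissible ic S) uS)
          (λ k Sk spk → false≢true (trans (sym (none k)) (trans (has-∧ S (specialSet m α) k) (cong₂ _∧_ Sk spk)))) k)
        (sym (has-⊥ m k))))

  -- On α-unimodal T ⊆ S the formula is the alternating sign on subsets of S ∩ special:
  -- subsets of the special set are automatically α-unimodal.
  formula-restricted : ∀ {m α} → IsComposition (suc m) α → ∀ S T →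
    (if admissible false (cuts m α) T ∧ does (T ⊆? S) then mobiusFormula m α T else + 0)
    ≡ (if does (T ⊆? (S ∩ specialSet m α)) then (- (+ 1)) ^ ∣ T ∣ else + 0)
  formula-restricted {m} {α} ic S T = restrict (T ⊆? specialSet m α)
    where
      sp = specialSet m α
      restrict : (d : Dec (T ⊆ sp)) →
        (if admissible false (cuts m α) T ∧ does (T ⊆? S) then (if does d then (- (+ 1)) ^ ∣ T ∣ else + 0) else + 0)
        ≡ (if does (T ⊆? (S ∩ sp)) then (- (+ 1)) ^ ∣ T ∣ else + 0)
      restrict (yes T⊆sp) rewrite special-admissible ic T T⊆sp =
        cong (λ b → if b then (- (+ 1)) ^ ∣ T ∣ else + 0)
             (does-cong (T ⊆? S) (T ⊆? (S ∩ sp)) (λ T⊆S → ⊆-∩ T⊆S T⊆sp) (λ T⊆ → p∩q⊆p S sp ∘ T⊆))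
      restrict (no T⊄sp) rewrite dec-false (T ⊆? (S ∩ sp)) (λ T⊆ → T⊄sp (p∩q⊆q S sp ∘ T⊆))
        with admissible false (cuts m α) T ∧ does (T ⊆? S)
      ... | true  = refl
      ... | false = refl

  -- The formula satisfies the recursion of the Möbius function: over the
  -- α-unimodal T ⊆ S it sums to the alternating sum over T ⊆ S ∩ special, which
  -- vanishes since S meets the special set.
  formula-sums-to-zero : ∀ {m α} → IsComposition (suc m) α → ∀ L → Enumerates (InU α) L →
    ∀ S → InU α S → S ≢ ⊥ → sumℤ (map (mobiusFormula m α) (filter (_⊆? S) L)) ≡ + 0
  formula-sums-to-zero {m} {α} ic L enumL S uS S≢⊥ =
    trans (sumℤ-enumerated m (λ T → InU α T × T ⊆ S) test test⇔ (filter (_⊆? S) L)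
                           (filter-enumerates enumL (_⊆? S)) (mobiusFormula m α))
      (trans (Σᶻ-cong m (formula-restricted ic S)) (alternating-sum (S ∩ specialSet m α) (unimodal-meets-special ic S uS S≢⊥)))
    where
      test : Subset m → Bool
      test T = admissible false (cuts m α) T ∧ does (T ⊆? S)
      test⇔ : ∀ T → (InU α T × T ⊆ S) ⇔ test T ≡ true
      test⇔ T = mk⇔ (λ (p : InU α T × T ⊆ S) →
                       ∧-intro (Equivalence.to (inU⇔admissible ic T) (proj₁ p)) (dec-true (T ⊆? S) (proj₂ p)))
                    (λ e → Equivalence.from (inU⇔admissible ic T) (∧-conicalˡ _ _ e) , does-true (T ⊆? S) (∧-conicalʳ _ _ e))

  mobius-formula : ∀ {m α} → IsComposition (suc m) α → ∀ L → Enumerates (InU α) L →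
    ∀ μ → MobiusFromEmpty L μ → ∀ S → InU α S → μ S ≡ mobiusFormula m α S
  mobius-formula {m} {α} ic L enumL@(uL , sound , complete) μ (μ⊥ , μ-sum) S uS = by-size (suc ∣ S ∣) S ≤-refl uS
    where
      by-size : ∀ k S → ∣ S ∣ < k → InU α S → μ S ≡ mobiusFormula m α S
      by-size (suc k) S |S|<k uS with ≡-dec Bool._≟_ S ⊥
      ... | yes refl rewrite dec-true (⊥ ⊆? specialSet m α) ⊥⊆ | ∣⊥∣≡0 m = μ⊥
      ... | no S≢⊥ =
        sumℤ-determines μ (mobiusFormula m α) (filter (_⊆? S) L) S (Unique.filter⁺ (_⊆? S) uL)
          (∈-filter⁺ (_⊆? S) (complete S uS) id) smaller
          (μ-sum S (complete S uS) S≢⊥) (formula-sums-to-zero ic L enumL S uS S≢⊥)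
        where
          smaller : ∀ T → T ∈ˡ filter (_⊆? S) L → T ≢ S → μ T ≡ mobiusFormula m α T
          smaller T T∈ T≢S with ∈-filter⁻ (_⊆? S) {xs = L} T∈
          ... | T∈L , T⊆S =
            by-size k T (≤-trans (≤∧≢⇒< (p⊆q⇒∣p∣≤∣q∣ T⊆S) (T≢S ∘ ⊆-size T⊆S)) (≤-pred |S|<k)) (sound T T∈L)

  partVII : ∀ n α → IsComposition n α → PartVII n α
  partVII n α ic = productOfChains n α ic , mobius n ic
    where
      mobius : ∀ n → IsComposition n α → ∀ (L : List (Subset (n ∸ 1))) → Enumerates (InU α) L →
        ∀ μ → MobiusFromEmpty L μ → ∀ S → InU α S →
        (InSpecial α S → μ S ≡ (- (+ 1)) ^ ∣ S ∣) × (¬ InSpecial α S → μ S ≡ + 0)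
      mobius zero    _  L _ μ (μ⊥ , _) [] _ =
        (λ _ → μ⊥) , λ notSpecial → ⊥-elim (notSpecial λ k k∈[] → ⊥-elim (no-element k∈[]))
        where no-element : ∀ {k} → k ∈ₙ ([] {A = Bool}) → Empty
              no-element (() , _)
      mobius (suc m) ic L enumL μ isMobius S uS =
        (λ inS → trans μS≡ (cong (λ b → if b then _ else + 0)
                                   (dec-true (S ⊆? specialSet m α) (Equivalence.to (inSpecial⇔⊆ ic S) inS)))) ,
        (λ notIn → trans μS≡ (cong (λ b → if b then _ else + 0)
                                     (dec-false (S ⊆? specialSet m α) (notIn ∘ Equivalence.from (inSpecial⇔⊆ ic S)))))
        where μS≡ = mobius-formula ic L enumL μ isMobius S uS

module CountingV where

  open import Defs
  open SubsetsAsVectors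
  open Blocks
  open Cuts
  open TransferForm
  open CutVectors
  open Enumeration
  open import Data.Nat
  open import Data.Nat.Properties
  open import Data.Bool using (Bool; true; false)
  open import Data.Vec using (Vec; []; _∷_)
  open import Data.List using (List; []; _∷_; length; map)
  open import Data.List.Properties using (length-map)
  open import Data.Nat.ListAction using (sum)
  open import Data.List.Relation.Unary.All using ([]; _∷_)
  open import Data.List.Relation.Unary.AllPairs using ([]; _∷_)
  open import Data.List.Relation.Unary.Any using (here)
  open import Data.Product using (_,_)
  open import Data.Empty using (⊥-elim)
  open import Relation.Binary.PropositionalEquality
  open import Data.Nat.Tactic.RingSolver using (solve-∀)

  compatible : Bool → ℕ → (ℕ → Bool) → ℕ
  compatible p m f = Σᴺ m (λ c → indicator (admissible p c (fromPred m f)))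

  compatible-cong : ∀ p m {f g} → (∀ k → 1 ≤ k → k ≤ m → f k ≡ g k) → compatible p m f ≡ compatible p m g
  compatible-cong p m f≡g = cong (λ s → Σᴺ m (λ c → indicator (admissible p c s))) (fromPred-cong m f≡g)

  compatible-out : ∀ p m f → f 1 ≡ false →
    compatible p (suc m) f ≡ compatible false m (λ k → f (suc k)) + compatible true m (λ k → f (suc k))
  compatible-out true  m f f₁≡f rewrite f₁≡f = refl
  compatible-out false m f f₁≡f rewrite f₁≡f = refl

  compatible-in : ∀ m f → f 1 ≡ true →
    compatible false (suc m) f ≡ compatible false m (λ k → f (suc k)) + compatible false m (λ k → f (suc k))
  compatible-in m f f₁≡t rewrite f₁≡t = refl

  compatible-in-blocked : ∀ m f → f 1 ≡ true → compatible true (suc m) f ≡ compatible false m (λ k → f (suc k))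
  compatible-in-blocked m f f₁≡t rewrite f₁≡t =
    trans (cong (compatible false m (λ k → f (suc k)) +_) (Σᴺ-zero m)) (+-identityʳ _)

  -- For the empty set every cut vector is admissible.
  compatible-empty : ∀ p m → compatible p m (λ _ → false) ≡ 2 ^ m
  compatible-empty p zero    = refl
  compatible-empty p (suc m) =
    trans (compatible-out p m (λ _ → false) refl)
          (trans (cong₂ _+_ (compatible-empty false m) (compatible-empty true m)) (double (2 ^ m)))
    where double : ∀ x → x + x ≡ 2 * x
          double = solve-∀

  -- A run of j+1 points outside s: both states merge after the first step and
  -- then double at each further step.
  compatible-run : ∀ j M f → (∀ k → 1 ≤ k → k ≤ suc j → f k ≡ false) → ∀ p →
    compatible p (suc j + M) f ≡ 2 ^ j * (compatible false M (λ k → f (suc j + k)) + compatible true M (λ k → f (suc j + k)))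
  compatible-run zero    M f out p = trans (compatible-out p M f (out 1 (s≤s z≤n) (s≤s z≤n))) (sym (+-identityʳ _))
  compatible-run (suc j) M f out p =
    trans (compatible-out p (suc j + M) f (out 1 (s≤s z≤n) (s≤s z≤n)))
          (trans (cong₂ _+_ (compatible-run j M _ out' false) (compatible-run j M _ out' true)) (double (2 ^ j) _))
    where
      out' : ∀ k → 1 ≤ k → k ≤ suc j → f (suc k) ≡ false
      out' k _ k≤ = out (suc k) (s≤s z≤n) (s≤s k≤)
      double : ∀ t x → t * x + t * x ≡ (2 * t) * x
      double = solve-∀

  CountFormula : ℕ → List ℕ → Set
  CountFormula a β =
    compatible false (a + sum β) (isCut (suc a ∷ β)) * 4 ^ countBig (suc a ∷ β) ≡ 2 ^ (a + sum β) * 3 ^ countBig (suc a ∷ β)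

  -- A first part of length 1: its cut doubles the count.
  count-unit-part : ∀ b bs → CountFormula b bs → CountFormula 0 (suc b ∷ bs)
  count-unit-part b bs ih =
    begin
      compatible false (suc m) f * F
    ≡⟨ cong (_* F) (trans (compatible-in m f refl) (cong₂ _+_ tail≡ tail≡)) ⟩
      (C + C) * F
    ≡⟨ double C F ⟩
      2 * (C * F)
    ≡⟨ cong (2 *_) ih ⟩
      2 * (2 ^ m * 3 ^ countBig (suc b ∷ bs))
    ≡⟨ sym (*-assoc 2 (2 ^ m) _) ⟩
      2 ^ suc m * 3 ^ countBig (suc b ∷ bs)
    ∎
    where
      open ≡-Reasoning
      m = b + sum bs
      f = isCut (1 ∷ suc b ∷ bs)
      F = 4 ^ countBig (suc b ∷ bs)
      C = compatible false m (isCut (suc b ∷ bs))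
      tail≡ : compatible false m (λ k → f (suc k)) ≡ C
      tail≡ = compatible-cong false m λ k 1≤k _ → cut-above 1 (suc b) bs k 1≤k
      double : ∀ x y → (x + x) * y ≡ 2 * (x * y)
      double = solve-∀
  -- A first part of length a+2: a run of a+1 non-cuts, then the cut, contribute
  -- 2^a · 3 = 2^{a+2} · 3/4.
  count-long-part : ∀ a b bs → CountFormula b bs → CountFormula (suc a) (suc b ∷ bs)
  count-long-part a b bs ih =
    begin
      compatible false (suc a + suc m) f * (4 * F)
    ≡⟨ cong (_* (4 * F)) (compatible-run a (suc m) f (λ k _ k≤ → cut-below (suc (suc a)) (suc b) bs k (s≤s k≤)) false) ⟩
      2 ^ a * (compatible false (suc m) g + compatible true (suc m) g) * (4 * F)
    ≡⟨ cong (λ z → 2 ^ a * z * (4 * F)) (cong₂ _+_ (compatible-in m g g₁≡t) (compatible-in-blocked m g g₁≡t)) ⟩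
      2 ^ a * ((C' + C') + C') * (4 * F)
    ≡⟨ cong (λ z → 2 ^ a * ((z + z) + z) * (4 * F)) tail≡ ⟩
      2 ^ a * ((C + C) + C) * (4 * F)
    ≡⟨ regroup (2 ^ a) C F ⟩
      12 * 2 ^ a * (C * F)
    ≡⟨ cong (12 * 2 ^ a *_) ih ⟩
      12 * 2 ^ a * (2 ^ m * 3 ^ countBig (suc b ∷ bs))
    ≡⟨ powers ⟩
      2 ^ (suc a + suc m) * (3 * 3 ^ countBig (suc b ∷ bs))
    ∎
    where
      open ≡-Reasoning
      m = b + sum bs
      f = isCut (suc (suc a) ∷ suc b ∷ bs)
      F = 4 ^ countBig (suc b ∷ bs)
      C = compatible false m (isCut (suc b ∷ bs))
      g : ℕ → Bool
      g k = f (suc a + k)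
      g₁≡t : g 1 ≡ true
      g₁≡t = trans (cong f (cong suc (+-comm a 1))) (cut-at (suc (suc a)) (suc b) bs)
      C' = compatible false m (λ k → g (suc k))
      tail≡ : C' ≡ C
      tail≡ = compatible-cong false m λ k 1≤k _ → trans (cong f (cong suc (+-suc a k))) (cut-above (suc (suc a)) (suc b) bs k 1≤k)
      regroup : ∀ t x y → t * ((x + x) + x) * (4 * y) ≡ 12 * t * (x * y)
      regroup = solve-∀
      powers : 12 * 2 ^ a * (2 ^ m * 3 ^ countBig (suc b ∷ bs)) ≡ 2 ^ (suc a + suc m) * (3 * 3 ^ countBig (suc b ∷ bs))
      powers rewrite ^-distribˡ-+-* 2 (suc a) (suc m) = arrange (2 ^ a) (2 ^ m) (3 ^ countBig (suc b ∷ bs))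
        where arrange : ∀ x y z → 12 * x * (y * z) ≡ (2 * x) * (2 * y) * (3 * z)
              arrange = solve-∀

  compatible-cuts : ∀ a β → PositiveParts β → CountFormula a β
  compatible-cuts a       []           _         = trans (*-identityʳ _) (trans (compatible-empty false (a + 0)) (sym (*-identityʳ _)))
  compatible-cuts zero    (suc b ∷ bs) (_ ∷ pos) = count-unit-part b bs (compatible-cuts b bs pos)
  compatible-cuts (suc a) (suc b ∷ bs) (_ ∷ pos) = count-long-part a b bs (compatible-cuts b bs pos)

  partVIII : ∀ n α → IsComposition n α → PartVIII n α
  partVIII zero α ic with composition-of-zero ic
  ... | refl = ([] ∷ []) , ((([] ∷ []) , sound , complete) , refl)
    where
      sound : ∀ γ → γ ∈ˡ ([] ∷ []) → InV 0 [] γ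
      sound γ (here refl) = ([] , refl) , λ { _ _ _ (1≤i , i≤0 , _) → ⊥-elim (<-irrefl refl (≤-trans 1≤i i≤0)) }
      complete : ∀ γ → InV 0 [] γ → γ ∈ˡ ([] ∷ [])
      complete γ (icγ , _) with composition-of-zero icγ
      ... | refl = here refl
  partVIII (suc m) α icα@(pos , sum≡) =
    L , compositions-select m admissibleWithα (λ γ → Unimodal γ (_∈S α)) (λ γ icγ → cutsUnimodal⇔admissible icγ icα) ,
    trans (cong (_* 4 ^ countBig α) (trans (length-map toComp (select admissibleWithα (allVec m))) (count-select m admissibleWithα)))
          (count pos sum≡)
    where
      admissibleWithα : Vec Bool m → Bool
      admissibleWithα c = admissible false c (cuts m α)
      L = map toComp (select admissibleWithα (allVec m))
      count : ∀ {α} → PositiveParts α → sum α ≡ suc m →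
              compatible false m (isCut α) * 4 ^ countBig α ≡ 2 ^ m * 3 ^ countBig α
      count {suc a ∷ β} (_ ∷ posβ) refl = compatible-cuts a β posβ

module RefinementIdeal where

  open import Defs
  open SubsetsAsVectors
  open Blocks
  open Cuts
  open LocalForm
  open TransferForm
  open CutVectors
  open import Data.Nat
  open import Data.Bool using (Bool; true; false; _∨_)
  open import Data.Bool.Properties using (∨-zeroʳ)
  open import Data.Vec using (Vec; zipWith)
  open import Data.List using (List; []; _∷_)
  open import Data.List.Relation.Unary.All using ([]; _∷_)
  open import Data.Product using (Σ; _×_; _,_; proj₁)
  open import Relation.Nullary using (¬_)
  open import Data.Empty using (⊥; ⊥-elim)
  open import Function.Bundles using (Equivalence)
  open import Relation.Binary.PropositionalEquality

  V-ideal : ∀ n α γ δ → IsComposition n δ → Refines δ γ → InV n α γ → InV n α δ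
  V-ideal n α γ δ icδ δ≤γ (icγ , u) = icδ , local⇒unimodal icδ (local-refine δ≤γ (unimodal⇒local icγ u))

  -- The meet of γ, δ ⊨ m+1 in the refinement order: its cut set is S_γ ∪ S_δ.
  meetCuts : ∀ m → List ℕ → List ℕ → Vec Bool m
  meetCuts m γ δ = zipWith _∨_ (cuts m γ) (cuts m δ)

  meet : ∀ m → List ℕ → List ℕ → List ℕ
  meet m γ δ = toComp (meetCuts m γ δ)

  meet-composition : ∀ m γ δ → IsComposition (suc m) (meet m γ δ)
  meet-composition m γ δ = toComp-composition (meetCuts m γ δ)

  has-cuts-meet : ∀ m γ δ k → has (cuts m (meet m γ δ)) k ≡ has (cuts m γ) k ∨ has (cuts m δ) k
  has-cuts-meet m γ δ k = trans (cong (λ v → has v k) (cuts-toComp (meetCuts m γ δ))) (has-∨ (cuts m γ) (cuts m δ) k)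

  meet-refines-left : ∀ {m γ δ} → IsComposition (suc m) γ → Refines (meet m γ δ) γ
  meet-refines-left {m} {γ} {δ} icγ k k∈Sγ = has-cuts⇒∈S (meet-composition m γ δ) k
    (trans (has-cuts-meet m γ δ k) (cong (_∨ has (cuts m δ) k) (∈S⇒has-cuts icγ k k∈Sγ)))

  meet-refines-right : ∀ {m γ δ} → IsComposition (suc m) δ → Refines (meet m γ δ) δ
  meet-refines-right {m} {γ} {δ} icδ k k∈Sδ = has-cuts⇒∈S (meet-composition m γ δ) k
    (trans (has-cuts-meet m γ δ k) (trans (cong (has (cuts m γ) k ∨_) (∈S⇒has-cuts icδ k k∈Sδ)) (∨-zeroʳ _)))

  meet-greatest : ∀ {m γ δ ζ} → IsComposition (suc m) γ → IsComposition (suc m) δ →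
    Refines ζ γ → Refines ζ δ → Refines ζ (meet m γ δ)
  meet-greatest {m} {γ} {δ} icγ icδ ζ≤γ ζ≤δ k k∈S
    with has (cuts m γ) k in eγ
  ... | true  = ζ≤γ k (has-cuts⇒∈S icγ k eγ)
  ... | false = ζ≤δ k (has-cuts⇒∈S icδ k
                  (trans (sym (trans (has-cuts-meet m γ δ k) (cong (_∨ has (cuts m δ) k) eγ)))
                         (∈S⇒has-cuts (meet-composition m γ δ) k k∈S)))

  partIX : ∀ n α → IsComposition n α → PartIX n α
  partIX n α _ = V-ideal n α , meet-in-V n
    where
      no-cuts-empty : ∀ k → ¬ k ∈S []
      no-cuts-empty k (_ , _ , () , _)
      meet-in-V : ∀ n γ δ → InV n α γ → InV n α δ →
        Σ (List ℕ) λ ε → InV n α ε × Refines ε γ × Refines ε δ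
          × (∀ ζ → IsComposition n ζ → Refines ζ γ → Refines ζ δ → Refines ζ ε)
      meet-in-V zero γ δ vγ vδ with composition-of-zero (proj₁ vγ) | composition-of-zero (proj₁ vδ)
      ... | refl | refl = [] , vγ , (λ _ p → p) , (λ _ p → p) , λ _ _ _ _ k p → ⊥-elim (no-cuts-empty k p)
      meet-in-V (suc m) γ δ vγ@(icγ , _) (icδ , _) =
        meet m γ δ , V-ideal (suc m) α γ _ (meet-composition m γ δ) (meet-refines-left {δ = δ} icγ) vγ ,
        meet-refines-left {δ = δ} icγ , meet-refines-right {γ = γ} icδ , λ ζ _ → meet-greatest icγ icδ

  -- (ix, second half)  α = (2,1): γ = (1,2) and α itself lie in V_α, but their
  -- join (3) does not, since S_α = {2} is not (3)-unimodal.
  partIXnot : PartIXnot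
  partIXnot =
    3 , α , γ , α , ε , icα , (icγ , Equivalence.from (cutsUnimodal⇔admissible icγ icα) refl) ,
    (icα , Equivalence.from (cutsUnimodal⇔admissible icα icα) refl) , icε ,
    (λ k p → ⊥-elim (no-cuts-singleton 3 k p)) , (λ k p → ⊥-elim (no-cuts-singleton 3 k p)) ,
    (λ ζ _ γ≤ζ α≤ζ k k∈Sζ → ⊥-elim (disjoint k (∈S⇒isCut (proj₁ icγ) (γ≤ζ k k∈Sζ))
                                                (∈S⇒isCut (proj₁ icα) (α≤ζ k k∈Sζ)))) ,
    λ { (_ , u) → false≢true (Equivalence.to (cutsUnimodal⇔admissible icε icα) u) }
    where
      α = 2 ∷ 1 ∷ []
      γ = 1 ∷ 2 ∷ []
      ε = 3 ∷ []
      icα : IsComposition 3 α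
      icα = (s≤s z≤n ∷ s≤s z≤n ∷ []) , refl
      icγ : IsComposition 3 γ
      icγ = (s≤s z≤n ∷ s≤s z≤n ∷ []) , refl
      icε : IsComposition 3 ε
      icε = (s≤s z≤n ∷ []) , refl
      disjoint : ∀ k → isCut γ k ≡ true → isCut α k ≡ true → ⊥
      disjoint zero                ()
      disjoint (suc zero)          _  ()
      disjoint (suc (suc zero))    ()
      disjoint (suc (suc (suc k))) ()

module GeneratingFunction where

  open import Defs using (sumℤ; genCoeff; IsComposition; Enumerates; InU; PartX)
  open SubsetsAsVectors
  open TransferForm
  open CutVectors
  open Enumeration
  open import Data.Nat using (ℕ; zero; suc)
  open import Data.Integer using (ℤ; +_; _+_; _*_; _-_; _^_)
  open import Data.Integer.Properties using (*-zeroʳ; *-identityʳ)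
  open import Data.Bool using (Bool; true; false; if_then_else_)
  open import Data.Vec using (Vec; _∷_)
  open import Data.Fin.Subset using (∣_∣)
  open import Data.List using (map; length)
  open import Data.Product using (_,_)
  open import Relation.Binary.PropositionalEquality
  open import Data.Integer.Tactic.RingSolver using (solve-∀)

  ΣΣ : ∀ m → (Vec Bool m → Vec Bool m → ℤ) → ℤ
  ΣΣ m g = Σᶻ m (λ c → Σᶻ m (g c))

  ΣΣ-split : ∀ m (g : Vec Bool (suc m) → Vec Bool (suc m) → ℤ) →
    ΣΣ (suc m) g ≡ (ΣΣ m (λ c s → g (true ∷ c) (true ∷ s)) + ΣΣ m (λ c s → g (true ∷ c) (false ∷ s)))
                 + (ΣΣ m (λ c s → g (false ∷ c) (true ∷ s)) + ΣΣ m (λ c s → g (false ∷ c) (false ∷ s)))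
  ΣΣ-split m g = cong₂ _+_ (Σᶻ-+ m _ _) (Σᶻ-+ m _ _)

  ΣΣ-cong : ∀ m {g h : Vec Bool m → Vec Bool m → ℤ} → (∀ c s → g c s ≡ h c s) → ΣΣ m g ≡ ΣΣ m h
  ΣΣ-cong m g≡ = Σᶻ-cong m λ c → Σᶻ-cong m (g≡ c)

  ΣΣ-scale : ∀ m a {g h : Vec Bool m → Vec Bool m → ℤ} → (∀ c s → g c s ≡ a * h c s) → ΣΣ m g ≡ a * ΣΣ m h
  ΣΣ-scale m a g≡ = trans (Σᶻ-cong m λ c → trans (Σᶻ-cong m (g≡ c)) (Σᶻ-* m a _)) (Σᶻ-* m a _)

  module _ (q t : ℤ) where

    weight : ∀ {m} → Bool → Vec Bool m → Vec Bool m → ℤ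
    weight p c s = if admissible p c s then q ^ ∣ s ∣ * t ^ ∣ c ∣ else + 0

    total : Bool → ℕ → ℤ
    total p m = ΣΣ m (weight p)

    private
      scale : ∀ b (k x y : ℤ) → y ≡ k * x → (if b then y else + 0) ≡ k * (if b then x else + 0)
      scale true  k x y y≡ = y≡
      scale false k x y _  = sym (*-zeroʳ k)

      swap₄ : ∀ q t x y → (q * x) * (t * y) ≡ (q * t) * (x * y)
      swap₄ = solve-∀
      swap₃ : ∀ t x y → x * (t * y) ≡ t * (x * y)
      swap₃ = solve-∀
      assoc : ∀ q x y → (q * x) * y ≡ q * (x * y)
      assoc = solve-∀

    weight-cut-in : ∀ {m} p (c s : Vec Bool m) → weight p (true ∷ c) (true ∷ s) ≡ (q * t) * weight false c s
    weight-cut-in true  c s = scale (admissible false c s) (q * t) _ _ (swap₄ q t (q ^ ∣ s ∣) (t ^ ∣ c ∣))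
    weight-cut-in false c s = scale (admissible false c s) (q * t) _ _ (swap₄ q t (q ^ ∣ s ∣) (t ^ ∣ c ∣))

    weight-cut-out : ∀ {m} p (c s : Vec Bool m) → weight p (true ∷ c) (false ∷ s) ≡ t * weight false c s
    weight-cut-out true  c s = scale (admissible false c s) t _ _ (swap₃ t (q ^ ∣ s ∣) (t ^ ∣ c ∣))
    weight-cut-out false c s = scale (admissible false c s) t _ _ (swap₃ t (q ^ ∣ s ∣) (t ^ ∣ c ∣))

    weight-in-free : ∀ {m} (c s : Vec Bool m) → weight false (false ∷ c) (true ∷ s) ≡ q * weight false c s
    weight-in-free c s = scale (admissible false c s) q _ _ (assoc q (q ^ ∣ s ∣) (t ^ ∣ c ∣))

    weight-in-blocked : ∀ {m} (c s : Vec Bool m) → weight true (false ∷ c) (true ∷ s) ≡ + 0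
    weight-in-blocked c s = refl

    weight-out : ∀ {m} p (c s : Vec Bool m) → weight p (false ∷ c) (false ∷ s) ≡ weight true c s
    weight-out true  c s = refl
    weight-out false c s = refl

    total-blocked : ∀ m → total true (suc m) ≡ (q * t + t) * total false m + total true m
    total-blocked m =
      trans (ΣΣ-split m (weight true))
        (trans (cong₂ _+_ (cong₂ _+_ (ΣΣ-scale m (q * t) (weight-cut-in true)) (ΣΣ-scale m t (weight-cut-out true)))
                          (cong₂ _+_ (ΣΣ-scale m (+ 0) {h = weight false} weight-in-blocked) (ΣΣ-cong m (weight-out true))))
               (collect q t (total false m) (total true m)))
      where
        collect : ∀ q t a b → ((q * t) * a + t * a) + (+ 0 * a + b) ≡ (q * t + t) * a + b
        collect = solve-∀

    total-free : ∀ m → total false (suc m) ≡ (q * t + t + q) * total false m + total true m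
    total-free m =
      trans (ΣΣ-split m (weight false))
        (trans (cong₂ _+_ (cong₂ _+_ (ΣΣ-scale m (q * t) (weight-cut-in false)) (ΣΣ-scale m t (weight-cut-out false)))
                          (cong₂ _+_ (ΣΣ-scale m q weight-in-free) (ΣΣ-cong m (weight-out false))))
               (collect q t (total false m) (total true m)))
      where
        collect : ∀ q t a b → ((q * t) * a + t * a) + (q * a + b) ≡ (q * t + t + q) * a + b
        collect = solve-∀

    -- Eliminating the blocked state gives the three-term recurrence.
    total-recurrence : ∀ m → total false (suc (suc m)) ≡ ((+ 1 + q) * (+ 1 + t)) * total false (suc m) - q * total false m
    total-recurrence m =
      begin
        total false (suc (suc m))
      ≡⟨ total-free (suc m) ⟩
        (q * t + t + q) * total false (suc m) + total true (suc m)
      ≡⟨ cong (_+_ ((q * t + t + q) * total false (suc m))) (total-blocked m) ⟩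
        (q * t + t + q) * total false (suc m) + ((q * t + t) * total false m + total true m)
      ≡⟨ cong (λ z → (q * t + t + q) * total false (suc m) + ((q * t + t) * total false m + z)) blocked-from-free ⟩
        (q * t + t + q) * total false (suc m) + ((q * t + t) * total false m + (total false (suc m) - (q * t + t + q) * total false m))
      ≡⟨ simplify q t (total false (suc m)) (total false m) ⟩
        ((+ 1 + q) * (+ 1 + t)) * total false (suc m) - q * total false m
      ∎
      where
        open ≡-Reasoning
        cancel : ∀ a x y → y ≡ (a * x + y) - a * x
        cancel = solve-∀
        blocked-from-free : total true m ≡ total false (suc m) - (q * t + t + q) * total false m
        blocked-from-free = trans (cancel (q * t + t + q) (total false m) (total true m))
                                  (cong (_- (q * t + t + q) * total false m) (sym (total-free m)))
        simplify : ∀ q t x' x → (q * t + t + q) * x' + ((q * t + t) * x + (x' - (q * t + t + q) * x))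
                                  ≡ ((+ 1 + q) * (+ 1 + t)) * x' - q * x
        simplify = solve-∀

  coefficient : ∀ C → (∀ n → Enumerates (IsComposition n) (C n)) →
    ∀ U → (∀ n α → IsComposition n α → Enumerates (InU α) (U n α)) →
    ∀ q t m → genCoeff C U q t (suc m) ≡ t * total q t false m
  coefficient C enumC U enumU q t m =
    trans (sumℤ-compositions m (C (suc m)) (enumC (suc m)) _)
      (trans (Σᶻ-cong m λ c → inner c (toComp-composition c)) (Σᶻ-* m t (λ c → Σᶻ m (weight q t false c))))
    where
      inner : ∀ (c : Vec Bool m) → IsComposition (suc m) (toComp c) →
        sumℤ (map (λ S → q ^ ∣ S ∣ * t ^ length (toComp c)) (U (suc m) (toComp c))) ≡ t * Σᶻ m (weight q t false c)
      inner c icγ =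
        trans (sumℤ-enumerated m (InU (toComp c)) (admissible false (cuts m (toComp c))) (inU⇔admissible icγ)
                               (U (suc m) (toComp c)) (enumU (suc m) (toComp c) icγ) _)
          (trans (Σᶻ-cong m pointwise) (Σᶻ-* m t (weight q t false c)))
        where
          pointwise : ∀ s → (if admissible false (cuts m (toComp c)) s then q ^ ∣ s ∣ * t ^ length (toComp c) else + 0)
                            ≡ t * weight q t false c s
          pointwise s rewrite cuts-toComp c | length-toComp c with admissible false c s
          ... | true  = shuffle t (q ^ ∣ s ∣) (t ^ ∣ c ∣)
            where shuffle : ∀ t x y → x * (t * y) ≡ t * (x * y)
                  shuffle = solve-∀
          ... | false = sym (*-zeroʳ t)

  partX : PartX
  partX C enumC U enumU q t = first , recurrence
    where
      c = coefficient C enumC U enumU q t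
      first : genCoeff C U q t 1 ≡ t
      first = trans (c 0) (*-identityʳ t)
      recurrence : ∀ n → genCoeff C U q t (suc (suc n))
                   ≡ ((+ 1 + q) * (+ 1 + t)) * genCoeff C U q t (suc n) - q * genCoeff C U q t n
      recurrence zero =
        trans (c 1) (trans (cong (t *_) (total-free q t 0))
          (trans (initial q t) (cong (λ z → ((+ 1 + q) * (+ 1 + t)) * z - q * + 0) (sym (c 0)))))
        where initial : ∀ q t → t * ((q * t + t + q) * + 1 + + 1) ≡ ((+ 1 + q) * (+ 1 + t)) * (t * + 1) - q * + 0
              initial = solve-∀
      recurrence (suc n) =
        trans (c (suc (suc n))) (trans (cong (t *_) (total-recurrence q t n))
          (trans (distribute ((+ 1 + q) * (+ 1 + t)) q t (total q t false (suc n)) (total q t false n))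
                 (sym (cong₂ (λ x y → ((+ 1 + q) * (+ 1 + t)) * x - q * y) (c (suc n)) (c n)))))
        where distribute : ∀ k q t a b → t * (k * a - q * b) ≡ k * (t * a) - q * (t * b)
              distribute = solve-∀

open LocalForm using (partI; partII; partIII; partIV; partVI)
open ChainDecomposition using (partV)
open MobiusFunction using (partVII)
open CountingV using (partVIII)
open RefinementIdeal using (partIX; partIXnot)
open GeneratingFunction using (partX)

proposition2p2 :
    (∀ (n : ℕ) (α β : List ℕ) → IsComposition n α → IsComposition n β →
       PartI n α × PartII n α β × PartIII α β × PartIV α × PartV n α
       × PartVI n α × PartVII n α × PartVIII n α × PartIX n α)
    × PartIXnot × PartX
proposition2p2 =
  (λ n α β icα icβ →
     partI n α icα , partII n α β icα icβ , partIII n α β icα , partIV n α icα , partV n α icα ,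
     partVI n α icα , partVII n α icα , partVIII n α icα , partIX n α icα) ,
  partIXnot , partX
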